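{- Let $n$ be a positive integer and let $p$ be a prime dividing $n$. Let $\omega_1=e^{2\pi i/p}$, $\omega_j=\omega_1^j$ for $0\le j\le p-1$, and $B=\{1,\omega_1,\ldots,\omega_{p-1}\}^n\subseteq\mathbb{C}^n$. Let $K(n,p)$ be the minimum $k$ for which there exist vectors $v_1,\ldots,v_k\in B$ such that for every $w\in B$ there is an $i$, $1\le i\le k$, with $v_i\cdot w=0$. Then $K(n,p)\ge n(p-1)$.
   Context: For $v=(v_1,\ldots,v_n),w=(w_1,\ldots,w_n)\in\mathbb{C}^n$, $v\cdot w$ denotes the usual (bilinear) scalar product $\sum_{j=1}^n v_jw_j$. -}

module Defs where

open import Data.Nat using (ℕ; zero; suc; _+_; _∸_; _≡ᵇ_; NonZero)
open import Data.Nat.DivMod using (_%_)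
open import Data.Fin using (Fin; toℕ) renaming (zero to fzero; suc to fsuc)
open import Data.Integer using (ℤ; +_; -_) renaming (_+_ to _+ℤ_)
open import Data.Bool using (if_then_else_)
open import Relation.Binary.PropositionalEquality using (_≡_)

-- The cyclotomic ring ℤ[ω] ⊂ ℂ, ω = e^{2πi/p}, p prime, represented in its
-- power basis 1, ω, …, ω^{p-2} (Φ_p is irreducible, so this basis is
-- ℤ-linearly independent in ℂ).
Cyc : ℕ → Set
Cyc p = Fin (p ∸ 1) → ℤ

-- coordinates of ω^m (m taken mod p; ω^{p-1} = -(1 + ω + … + ω^{p-2}))
ωpow : (p : ℕ) → .{{_ : NonZero p}} → ℕ → Cyc p
ωpow p m i =
  if (m % p) ≡ᵇ toℕ i then + 1
  else if (m % p) ≡ᵇ (p ∸ 1) then - (+ 1)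
  else + 0

sumFin : (n : ℕ) → (Fin n → ℤ) → ℤ
sumFin zero f = + 0
sumFin (suc n) f = f fzero +ℤ sumFin n (λ j → f (fsuc j))

-- An element of B = {1, ω, …, ω^{p-1}}^n is encoded by its exponent vector:
-- a : Fin n → Fin p stands for (ω^{a 0}, …, ω^{a (n-1)}).
B : ℕ → ℕ → Set
B n p = Fin n → Fin p

-- bilinear scalar product v · w = Σ_j ω^{a_j} ω^{b_j} = Σ_j ω^{a_j + b_j}, in ℤ[ω]
dot : (n p : ℕ) → .{{_ : NonZero p}} → B n p → B n p → Cyc p
dot n p a b i = sumFin n (λ j → ωpow p (toℕ (a j) + toℕ (b j)) i)

-- being zero (as a complex number) = all power-basis coordinates vanish
IsZero : (p : ℕ) → Cyc p → Set
IsZero p x = ∀ i → x i ≡ + 0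

-- Write w ∈ B as an exponent vector b ∈ [0, p)ⁿ and put cⱼ = aⱼ + bⱼ for a covering vector a.
-- As Φₚ is the minimal polynomial of ω, a · w = 0 forces every residue mod p to occur exactly
-- q = n / p times among the cⱼ, hence Σⱼ cⱼ ≡ q (0 + 1 + ⋯ + (p - 1)) (mod p): the vectors b
-- covered by a all lie in the class Σ b ≡ -u(a) for a residue u(a) depending on a only.  So it
-- suffices to show p |L| ≥ n (p - 1) for the list L of covering vectors with u(a) = u, which must
-- cover the whole class Σ b ≡ -u; summing over the p classes gives p k ≥ p n (p - 1).
--
-- For b ∈ [0, p)ⁿ consider F = Πₐ∈L Σⱼ X^(aⱼ + bⱼ) in ℤ[X]/(Xᵖ - 1).  If some factor vanishes at ω,
-- F is a multiple of 1 + X + ⋯ + Xᵖ⁻¹, i.e. constant; if no factor satisfies the residue-sum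
-- congruence, every factor raises the (1 - X)-adic valuation by exactly one with a quotient that
-- stays a unit mod (p, 1 - X), so F is not constant.  The energy Σᵣ,ᵣ′ (Fᵣ - Fᵣ′)² / 2 detects
-- this: summed over the class Σ b ≡ -u it is 0, summed over Σ b ≡ -u - 1 it is positive.  Expanded
-- over pairs of index paths, each pair term depends only on the difference of the path values
-- mod p, and if p |L| < n (p - 1) every pair admits a translation b ↦ b + τ with Σ τ ≡ 1 that
-- maps one class onto the other and preserves the pair term, forcing the two sums to agree.

module Submission where

open import Defs

module Covering where

  open import Data.Nat.Base as ℕ using (ℕ; zero; suc; NonZero; _∸_; _≡ᵇ_)
  import Data.Nat.Properties as ℕ
  import Data.Nat.Divisibility as ℕ
  open import Data.Nat.DivMod using (_%_; _/_; m<n⇒m%n≡m; m%n<n; m%n≤m; m≡m%n+[m/n]*n; [m+n]%n≡m%n; %-distribˡ-+; m%n%n≡m%n; %-remove-+ʳ)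
  open import Data.Nat.Primality using (Prime; euclidsLemma; prime⇒nonTrivial)
  open import Data.Nat.Coprimality using (coprime-Bézout; prime⇒coprime)
  open import Data.Nat.GCD using (module Bézout)
  import Data.Nat.Tactic.RingSolver as ℕ-Solver
  open import Data.Bool.Base using (Bool; true; false; if_then_else_)
  open import Data.Bool.Properties using (T-≡)
  open import Data.Integer.Base using (ℤ; +_; -_; -[1+_]; +[1+_]; _+_; _-_; _*_; _≤_; _<_; ∣_∣; +≤+; +<+; nonNegative)
  open import Data.Integer.Properties
  open import Data.Integer.Divisibility.Signed using (_∣_; _∣?_; divides; ∣⇒∣ᵤ; ∣ᵤ⇒∣; ∣m⇒∣-m; ∣m∣n⇒∣m+n; ∣m∣n⇒∣m-n; ∣n⇒∣m*n; ∣-refl)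
  open import Data.Integer.DivMod using (_%ℕ_; _/ℕ_; n%ℕd<d; a≡a%ℕn+[a/ℕn]*n)
  open import Data.Integer.Tactic.RingSolver using (solve-∀)
  open import Data.Fin.Base using (Fin; toℕ; fromℕ<) renaming (zero to fzero; suc to fsuc)
  import Data.Fin.Properties as Fin
  open import Data.Vec.Base using (Vec; []; _∷_; lookup; tabulate; replicate)
  import Data.Vec.Properties as Vec
  open import Data.Vec.Relation.Unary.All using ([]; _∷_) renaming (All to AllVec)
  open import Data.List.Base using (List; []; _∷_; length; filter)
  import Data.List.Base as List
  open import Data.List.Properties using (filter-accept; length-tabulate)
  open import Data.List.Relation.Unary.All using (All; []; _∷_)
  import Data.List.Relation.Unary.All as All
  open import Data.List.Relation.Unary.All.Properties using (all-filter)
  open import Data.List.Relation.Unary.Any using (Any; here; there)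
  open import Data.List.Relation.Unary.Any.Properties using () renaming (tabulate⁺ to any-tabulate⁺)
  open import Data.Product using (Σ-syntax; ∃; _×_; _,_; proj₁; proj₂)
  open import Data.Sum using (_⊎_; inj₁; inj₂; [_,_]′)
  open import Data.Empty using (⊥-elim)
  open import Function.Bundles using (_⇔_; mk⇔; Equivalence)
  open import Relation.Nullary using (¬_; Dec; does; yes; no)
  open import Relation.Nullary.Decidable using (dec-true; dec-false; decidable-stable; ¬?)
  open import Relation.Unary using (Decidable)
  open import Relation.Binary.PropositionalEquality

  -- Linear sums

  record IsLinearSum {A : Set} (S : (A → ℤ) → ℤ) : Set where
    field
      sum-cong : ∀ {f g} → (∀ x → f x ≡ g x) → S f ≡ S g
      sum-+ : ∀ f g → S (λ x → f x + g x) ≡ S f + S g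
      sum-*ˡ : ∀ c f → S (λ x → c * f x) ≡ c * S f
      sum-nonneg : ∀ f → (∀ x → + 0 ≤ f x) → + 0 ≤ S f

    sum-zero : S (λ _ → + 0) ≡ + 0
    sum-zero = trans (sum-*ˡ (+ 0) (λ _ → + 0)) (*-zeroˡ (S (λ _ → + 0)))

    sum-neg : ∀ f → S (λ x → - f x) ≡ - S f
    sum-neg f = trans (sum-cong (λ x → sym (-1*i≡-i (f x)))) (trans (sum-*ˡ (- + 1) f) (-1*i≡-i (S f)))

    sum-- : ∀ f g → S (λ x → f x - g x) ≡ S f - S g
    sum-- f g = trans (sum-+ f (λ x → - g x)) (cong (λ t → S f + t) (sum-neg g))

    sum-*ʳ : ∀ c f → S (λ x → f x * c) ≡ S f * c
    sum-*ʳ c f = trans (sum-cong (λ x → *-comm (f x) c)) (trans (sum-*ˡ c f) (*-comm c (S f)))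

    sum-mono : ∀ f g → (∀ x → f x ≤ g x) → S f ≤ S g
    sum-mono f g f≤g = 0≤i-j⇒j≤i (≤-trans (sum-nonneg (λ x → g x - f x) (λ x → i≤j⇒0≤j-i (f≤g x))) (≤-reflexive (sum-- g f)))

  open IsLinearSum public

  Fubini : {A : Set} → ((A → ℤ) → ℤ) → Set₁
  Fubini {A} S = ∀ {B : Set} {T : (B → ℤ) → ℤ} → IsLinearSum T → (f : A → B → ℤ) →
    S (λ x → T (f x)) ≡ T (λ y → S (λ x → f x y))

  ∑< : ℕ → (ℕ → ℤ) → ℤ
  ∑< zero f = + 0
  ∑< (suc m) f = ∑< m f + f m

  private
    +-interchange : ∀ a b c d → a + b + (c + d) ≡ a + c + (b + d)
    +-interchange = solve-∀

  sumFin-linear : ∀ n → IsLinearSum (sumFin n)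
  sumFin-linear n = record { sum-cong = go-cong n ; sum-+ = go-+ n ; sum-*ˡ = go-* n ; sum-nonneg = go-nonneg n }
    where
    go-cong : ∀ n {f g} → (∀ x → f x ≡ g x) → sumFin n f ≡ sumFin n g
    go-cong zero f≡g = refl
    go-cong (suc n) f≡g = cong₂ _+_ (f≡g fzero) (go-cong n (λ x → f≡g (fsuc x)))
    go-+ : ∀ n f g → sumFin n (λ x → f x + g x) ≡ sumFin n f + sumFin n g
    go-+ zero f g = refl
    go-+ (suc n) f g = trans (cong (λ t → f fzero + g fzero + t) (go-+ n (λ x → f (fsuc x)) (λ x → g (fsuc x))))
                             (+-interchange (f fzero) (g fzero) _ _)
    go-* : ∀ n c f → sumFin n (λ x → c * f x) ≡ c * sumFin n f
    go-* zero c f = sym (*-zeroʳ c)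
    go-* (suc n) c f = trans (cong (λ t → c * f fzero + t) (go-* n c (λ x → f (fsuc x)))) (sym (*-distribˡ-+ c (f fzero) _))
    go-nonneg : ∀ n f → (∀ x → + 0 ≤ f x) → + 0 ≤ sumFin n f
    go-nonneg zero f f≥0 = ≤-refl
    go-nonneg (suc n) f f≥0 = +-mono-≤ (f≥0 fzero) (go-nonneg n (λ x → f (fsuc x)) (λ x → f≥0 (fsuc x)))

  ∑<-linear : ∀ m → IsLinearSum (∑< m)
  ∑<-linear m = record { sum-cong = go-cong m ; sum-+ = go-+ m ; sum-*ˡ = go-* m ; sum-nonneg = go-nonneg m }
    where
    go-cong : ∀ m {f g} → (∀ x → f x ≡ g x) → ∑< m f ≡ ∑< m g
    go-cong zero f≡g = refl
    go-cong (suc m) f≡g = cong₂ _+_ (go-cong m f≡g) (f≡g m)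
    go-+ : ∀ m f g → ∑< m (λ x → f x + g x) ≡ ∑< m f + ∑< m g
    go-+ zero f g = refl
    go-+ (suc m) f g = trans (cong (_+ (f m + g m)) (go-+ m f g)) (+-interchange (∑< m f) (∑< m g) _ _)
    go-* : ∀ m c f → ∑< m (λ x → c * f x) ≡ c * ∑< m f
    go-* zero c f = sym (*-zeroʳ c)
    go-* (suc m) c f = trans (cong (_+ c * f m) (go-* m c f)) (sym (*-distribˡ-+ c (∑< m f) _))
    go-nonneg : ∀ m f → (∀ x → + 0 ≤ f x) → + 0 ≤ ∑< m f
    go-nonneg zero f f≥0 = ≤-refl
    go-nonneg (suc m) f f≥0 = +-mono-≤ (go-nonneg m f f≥0) (f≥0 m)

  nested-linear : ∀ {X Y A : Set} {S : (X → ℤ) → ℤ} {T : (Y → ℤ) → ℤ} →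
    IsLinearSum S → IsLinearSum T → (g : X → Y → A) → IsLinearSum (λ f → S (λ x → T (λ y → f (g x y))))
  nested-linear S T g = record
    { sum-cong = λ e → sum-cong S (λ x → sum-cong T (λ y → e (g x y)))
    ; sum-+ = λ f h → trans (sum-cong S (λ x → sum-+ T _ _)) (sum-+ S _ _)
    ; sum-*ˡ = λ c f → trans (sum-cong S (λ x → sum-*ˡ T c _)) (sum-*ˡ S c _)
    ; sum-nonneg = λ f h → sum-nonneg S _ (λ x → sum-nonneg T _ (λ y → h (g x y)))
    }

  sumFin-fubini : ∀ n → Fubini (sumFin n)
  sumFin-fubini zero T f = sym (sum-zero T)
  sumFin-fubini (suc n) {T = T} T-lin f =
    trans (cong (λ t → T (f fzero) + t) (sumFin-fubini n T-lin (λ x → f (fsuc x))))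
          (sym (sum-+ T-lin (f fzero) (λ y → sumFin n (λ x → f (fsuc x) y))))

  ∑<-fubini : ∀ m → Fubini (∑< m)
  ∑<-fubini zero T f = sym (sum-zero T)
  ∑<-fubini (suc m) {T = T} T-lin f =
    trans (cong (_+ T (f m)) (∑<-fubini m T-lin f)) (sym (sum-+ T-lin (λ y → ∑< m (λ x → f x y)) (f m)))

  nested-fubini : ∀ {X Y A : Set} {S : (X → ℤ) → ℤ} {T : (Y → ℤ) → ℤ} →
    IsLinearSum S → Fubini S → Fubini T → (g : X → Y → A) → Fubini (λ f → S (λ x → T (λ y → f (g x y))))
  nested-fubini {T = T} S-lin S-fub T-fub g U-lin f =
    trans (sum-cong S-lin (λ x → T-fub U-lin (λ y → f (g x y)))) (S-fub U-lin (λ x z → T (λ y → f (g x y) z)))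

  ∑<-const : ∀ m c → ∑< m (λ _ → c) ≡ + m * c
  ∑<-const zero c = sym (*-zeroˡ c)
  ∑<-const (suc m) c = trans (cong (_+ c) (∑<-const m c)) (trans (+-comm (+ m * c) c) (sym (suc-* (+ m) c)))

  sumFin-const : ∀ n c → sumFin n (λ _ → c) ≡ + n * c
  sumFin-const zero c = sym (*-zeroˡ c)
  sumFin-const (suc n) c = trans (cong (λ t → c + t) (sumFin-const n c)) (sym (suc-* (+ n) c))

  ∑<-telescope : ∀ m (z : ℕ → ℤ) → ∑< m (λ s → z s - z (suc s)) ≡ z 0 - z m
  ∑<-telescope zero z = sym (+-inverseʳ (z 0))
  ∑<-telescope (suc m) z = trans (cong (_+ (z m - z (suc m))) (∑<-telescope m z)) (cancel-middle (z 0) (z m) (z (suc m)))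
    where
    cancel-middle : ∀ a b c → a - b + (b - c) ≡ a - c
    cancel-middle = solve-∀

  ∑<-cong-< : ∀ m {f g : ℕ → ℤ} → (∀ x → x ℕ.< m → f x ≡ g x) → ∑< m f ≡ ∑< m g
  ∑<-cong-< zero f≡g = refl
  ∑<-cong-< (suc m) f≡g = cong₂ _+_ (∑<-cong-< m (λ x x<m → f≡g x (ℕ.m<n⇒m<1+n x<m))) (f≡g m ℕ.≤-refl)

  ∑<-mono-< : ∀ m (f g : ℕ → ℤ) → (∀ x → x ℕ.< m → f x ≤ g x) → ∑< m f ≤ ∑< m g
  ∑<-mono-< zero f g f≤g = ≤-refl
  ∑<-mono-< (suc m) f g f≤g = +-mono-≤ (∑<-mono-< m f g (λ x x<m → f≤g x (ℕ.m<n⇒m<1+n x<m))) (f≤g m ℕ.≤-refl)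

  ∑<-term≤ : ∀ m f x → (∀ y → + 0 ≤ f y) → x ℕ.< m → f x ≤ ∑< m f
  ∑<-term≤ (suc m) f x f≥0 x<1+m with x ℕ.≟ m
  ... | yes refl = i≤j+i (f m) (∑< m f) {{nonNegative (sum-nonneg (∑<-linear m) f f≥0)}}
  ... | no x≢m = ≤-trans (∑<-term≤ m f x f≥0 (ℕ.≤∧≢⇒< (ℕ.≤-pred x<1+m) x≢m)) (i≤i+j (∑< m f) (f m) {{nonNegative (f≥0 m)}})

  -- Periodic sequences and the difference operator

  Seq : Set
  Seq = ℕ → ℤ

  Δ : Seq → Seq
  Δ z r = z r - z (suc r)

  Δ^ : ℕ → Seq → Seq
  Δ^ zero z = z
  Δ^ (suc m) z = Δ (Δ^ m z)

  window : ℕ → Seq → Seq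
  window c z r = ∑< c (λ s → z (r ℕ.+ s))

  Δ^-cong : ∀ m {y z} → y ≗ z → Δ^ m y ≗ Δ^ m z
  Δ^-cong zero y≗z = y≗z
  Δ^-cong (suc m) y≗z r = cong₂ _-_ (Δ^-cong m y≗z r) (Δ^-cong m y≗z (suc r))

  Δ^-linear : ∀ {I : Set} {S : (I → ℤ) → ℤ} → IsLinearSum S → ∀ m (f : I → Seq) r →
    Δ^ m (λ s → S (λ i → f i s)) r ≡ S (λ i → Δ^ m (f i) r)
  Δ^-linear S-lin zero f r = refl
  Δ^-linear S-lin (suc m) f r =
    trans (cong₂ _-_ (Δ^-linear S-lin m f r) (Δ^-linear S-lin m f (suc r))) (sym (sum-- S-lin _ _))

  Δ^-+ : ∀ m y z r → Δ^ m (λ s → y s + z s) r ≡ Δ^ m y r + Δ^ m z r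
  Δ^-+ zero y z r = refl
  Δ^-+ (suc m) y z r =
    trans (cong₂ _-_ (Δ^-+ m y z r) (Δ^-+ m y z (suc r))) (regroup (Δ^ m y r) (Δ^ m z r) (Δ^ m y (suc r)) (Δ^ m z (suc r)))
    where
    regroup : ∀ a b c d → a + b - (c + d) ≡ a - c + (b - d)
    regroup = solve-∀

  Δ^-const : ∀ m C r → Δ^ m (λ _ → C) r ≡ Δ^ m (λ _ → C) 0
  Δ^-const zero C r = refl
  Δ^-const (suc m) C r =
    cong₂ _-_ (trans (Δ^-const m C r) (sym (Δ^-const m C 0))) (trans (Δ^-const m C (suc r)) (sym (Δ^-const m C 1)))

  Δ^-shift : ∀ m z c r → Δ^ m (λ s → z (s ℕ.+ c)) r ≡ Δ^ m z (r ℕ.+ c)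
  Δ^-shift zero z c r = refl
  Δ^-shift (suc m) z c r = cong₂ _-_ (Δ^-shift m z c r) (Δ^-shift m z c (suc r))

  Δ^-Δ : ∀ m z r → Δ^ m (Δ z) r ≡ Δ^ (suc m) z r
  Δ^-Δ zero z r = refl
  Δ^-Δ (suc m) z r = cong₂ _-_ (Δ^-Δ m z r) (Δ^-Δ m z (suc r))

  shift≡Δ-window : ∀ z c r → z (r ℕ.+ c) ≡ z r - Δ (window c z) r
  shift≡Δ-window z c r = begin
    z (r ℕ.+ c)                 ≡⟨ sym (a-[a-b]≡b (z r) _) ⟩
    z r - (z r - z (r ℕ.+ c))   ≡⟨ cong (λ t → z r - (z t - z (r ℕ.+ c))) (sym (ℕ.+-identityʳ r)) ⟩
    z r - (w 0 - w c)           ≡⟨ cong (λ t → z r - t) (sym Δ-window) ⟩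
    z r - Δ (window c z) r      ∎
    where
    open ≡-Reasoning
    w : ℕ → ℤ
    w s = z (r ℕ.+ s)
    a-[a-b]≡b : ∀ a b → a - (a - b) ≡ b
    a-[a-b]≡b = solve-∀
    Δ-window : Δ (window c z) r ≡ w 0 - w c
    Δ-window = trans (cong (λ t → ∑< c w - t) (sum-cong (∑<-linear c) (λ s → cong z (sym (ℕ.+-suc r s)))))
                     (trans (sym (sum-- (∑<-linear c) w (λ s → w (suc s)))) (∑<-telescope c w))

  module PeriodicSequences (p : ℕ) {{_ : NonZero p}} where

    infix 4 p∣_
    p∣_ : ℤ → Set
    p∣ x = + p ∣ x

    Periodic : Seq → Set
    Periodic z = ∀ r → z (r ℕ.+ p) ≡ z r

    periodSum : Seq → ℤ
    periodSum z = ∑< p z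

    Δ-periodic : ∀ {z} → Periodic z → Periodic (Δ z)
    Δ-periodic z-per r = cong₂ _-_ (z-per r) (z-per (suc r))

    Δ^-periodic : ∀ m {z} → Periodic z → Periodic (Δ^ m z)
    Δ^-periodic zero z-per = z-per
    Δ^-periodic (suc m) z-per = Δ-periodic (Δ^-periodic m z-per)

    window-periodic : ∀ c {z} → Periodic z → Periodic (window c z)
    window-periodic c {z} z-per r = sum-cong (∑<-linear c) (λ s → trans (cong z (swap-+ r s)) (z-per (r ℕ.+ s)))
      where
      swap-+ : ∀ a b → a ℕ.+ p ℕ.+ b ≡ a ℕ.+ b ℕ.+ p
      swap-+ a b = trans (ℕ.+-assoc a p b) (trans (cong (a ℕ.+_) (ℕ.+-comm p b)) (sym (ℕ.+-assoc a b p)))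

    sum-periodic : ∀ {I : Set} {S : (I → ℤ) → ℤ} → IsLinearSum S → {f : I → Seq} → (∀ i → Periodic (f i)) →
      Periodic (λ r → S (λ i → f i r))
    sum-periodic S-lin f-per r = sum-cong S-lin (λ i → f-per i r)

    periodSum-from : ∀ {z} → Periodic z → ∀ x → ∑< p (λ s → z (x ℕ.+ s)) ≡ periodSum z
    periodSum-from z-per zero = refl
    periodSum-from {z} z-per (suc x) = trans shift (periodSum-from z-per x)
      where
      w : ℕ → ℤ
      w s = z (x ℕ.+ s)
      difference : ∑< p w - ∑< p (λ s → w (suc s)) ≡ + 0
      difference = begin
        ∑< p w - ∑< p (λ s → w (suc s))  ≡⟨ sym (sum-- (∑<-linear p) w (λ s → w (suc s))) ⟩
        ∑< p (λ s → w s - w (suc s))     ≡⟨ ∑<-telescope p w ⟩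
        w 0 - w p                        ≡⟨ cong (λ t → w 0 - t) (trans (z-per x) (cong z (sym (ℕ.+-identityʳ x)))) ⟩
        w 0 - w 0                        ≡⟨ +-inverseʳ (w 0) ⟩
        + 0                              ∎
        where open ≡-Reasoning
      shift : ∑< p (λ s → z (suc x ℕ.+ s)) ≡ ∑< p w
      shift = trans (sum-cong (∑<-linear p) (λ s → cong z (sym (ℕ.+-suc x s)))) (sym (i-j≡0⇒i≡j _ _ difference))

    periodSum-Δ : ∀ {z} → Periodic z → periodSum (Δ z) ≡ + 0
    periodSum-Δ {z} z-per = trans (∑<-telescope p z) (trans (cong (λ t → z 0 - t) (z-per 0)) (+-inverseʳ (z 0)))

    periodSum-window : ∀ {z} → Periodic z → ∀ c → periodSum (window c z) ≡ + c * periodSum z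
    periodSum-window {z} z-per c = begin
      ∑< p (λ s → ∑< c (λ t → z (s ℕ.+ t)))  ≡⟨ ∑<-fubini p (∑<-linear c) (λ s t → z (s ℕ.+ t)) ⟩
      ∑< c (λ t → ∑< p (λ s → z (s ℕ.+ t)))  ≡⟨ sum-cong (∑<-linear c) (λ t → trans (sum-cong (∑<-linear p) (λ s → cong z (ℕ.+-comm s t))) (periodSum-from z-per t)) ⟩
      ∑< c (λ t → periodSum z)               ≡⟨ ∑<-const c (periodSum z) ⟩
      + c * periodSum z                      ∎
      where open ≡-Reasoning

    Δ-const⇒const : ∀ {z} → Periodic z → ∀ K → (∀ r → Δ z r ≡ K) → ∀ r → z r ≡ z 0
    Δ-const⇒const {z} z-per K Δz≡K = go
      where
      p*K≡0 : + p * K ≡ + 0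
      p*K≡0 = trans (sym (∑<-const p K)) (trans (sum-cong (∑<-linear p) (λ r → sym (Δz≡K r))) (periodSum-Δ z-per))
      K≡0 : K ≡ + 0
      K≡0 = *-cancelˡ-≡ (+ p) K (+ 0) (trans p*K≡0 (sym (*-zeroʳ (+ p))))
      step : ∀ r → z (suc r) ≡ z r
      step r = sym (i-j≡0⇒i≡j _ _ (trans (Δz≡K r) K≡0))
      go : ∀ r → z r ≡ z 0
      go zero = refl
      go (suc r) = trans (step r) (go r)

    Δ^-const⇒const : ∀ {z} → Periodic z → ∀ m K → (∀ r → Δ^ m z r ≡ K) → ∀ r → z r ≡ z 0
    Δ^-const⇒const z-per zero K z≡K r = trans (z≡K r) (sym (z≡K 0))
    Δ^-const⇒const {z} z-per (suc m) K Δ^z≡K =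
      Δ^-const⇒const z-per m (Δ^ m z 0) (Δ-const⇒const (Δ^-periodic m z-per) K Δ^z≡K)

    const⇒p∣periodSum : ∀ {z} → (∀ r → z r ≡ z 0) → p∣ periodSum z
    const⇒p∣periodSum {z} z-const =
      divides (z 0) (trans (sum-cong (∑<-linear p) z-const) (trans (∑<-const p (z 0)) (*-comm (+ p) (z 0))))

    -- Working in ℤ[X]/(Xᵖ - 1) with Δ = 1 - X, this says that z - K is divisible by (1 - X)ᵐ
    -- with a quotient U that is a unit modulo the ideal (p, 1 - X).
    DiffForm : ℕ → Seq → Set
    DiffForm m z = Σ[ U ∈ Seq ] Σ[ K ∈ ℤ ] Periodic U × (∀ r → z r ≡ Δ^ m U r + K) × ¬ (p∣ periodSum U)

    DiffForm⇒nonconstant : ∀ m z → DiffForm m z → ¬ (∀ r → z r ≡ z 0)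
    DiffForm⇒nonconstant m z (U , K , U-per , z≡ , p∤U) z-const =
      p∤U (const⇒p∣periodSum (Δ^-const⇒const U-per m (z 0 - K) Δ^U≡))
      where
      a+b-b≡a : ∀ a b → a + b - b ≡ a
      a+b-b≡a = solve-∀
      Δ^U≡ : ∀ r → Δ^ m U r ≡ z 0 - K
      Δ^U≡ r = trans (sym (a+b-b≡a (Δ^ m U r) K)) (cong (_- K) (trans (sym (z≡ r)) (z-const r)))

    DiffForm-cong : ∀ m {y z} → y ≗ z → DiffForm m y → DiffForm m z
    DiffForm-cong m y≗z (U , K , U-per , y≡ , p∤U) = U , K , U-per , (λ r → trans (sym (y≗z r)) (y≡ r)) , p∤U

  𝟙 : Bool → ℤ
  𝟙 true = + 1
  𝟙 false = + 0

  shiftSum : ∀ {n} → (Fin n → ℕ) → Seq → Seq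
  shiftSum {n} c z r = sumFin n (λ j → z (r ℕ.+ c j))

  module Convolution (p : ℕ) {{_ : NonZero p}} (p-prime : Prime p) where
    open PeriodicSequences p

    residueSum : ℤ
    residueSum = ∑< p (λ r → + r)

    balancedSum : ℕ → ℤ
    balancedSum q = + q * residueSum

    p∣xy⇒p∣x⊎p∣y : ∀ x y → p∣ x * y → p∣ x ⊎ p∣ y
    p∣xy⇒p∣x⊎p∣y x y p∣xy with euclidsLemma ∣ x ∣ ∣ y ∣ p-prime (subst (p ℕ.∣_) (abs-* x y) (∣⇒∣ᵤ p∣xy))
    ... | inj₁ p∣x = inj₁ (∣ᵤ⇒∣ p∣x)
    ... | inj₂ p∣y = inj₂ (∣ᵤ⇒∣ p∣y)

    -- Summing z (s + r) = z s - Δ (window r z) s over r < p, and using n = q p, gives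
    -- shiftSum c U = q · periodSum U + Δ U′ for the periodic U′ below.
    module ShiftSum {n q : ℕ} (n≡qp : n ≡ q ℕ.* p) (c : Fin n → ℕ) {U : Seq} (U-per : Periodic U) where
      open ≡-Reasoning

      allWindows cWindows U′ : Seq
      allWindows s = ∑< p (λ r → window r U s)
      cWindows s = sumFin n (λ j → window (c j) U s)
      U′ s = + q * allWindows s - cWindows s

      p*U≡ : ∀ s → + p * U s ≡ periodSum U + Δ allWindows s
      p*U≡ s = begin
        + p * U s                                                   ≡⟨ sym (∑<-const p (U s)) ⟩
        ∑< p (λ _ → U s)                                            ≡⟨ sum-cong (∑<-linear p) (λ r → sym (a-b+b≡a (shift≡Δ-window U r s))) ⟩
        ∑< p (λ r → U (s ℕ.+ r) + Δ (window r U) s)                 ≡⟨ sum-+ (∑<-linear p) _ _ ⟩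
        ∑< p (λ r → U (s ℕ.+ r)) + ∑< p (λ r → Δ (window r U) s)    ≡⟨ cong₂ _+_ (periodSum-from U-per s) (sym (Δ^-linear (∑<-linear p) 1 (λ r → window r U) s)) ⟩
        periodSum U + Δ allWindows s                                ∎
        where
        a-b+b≡a : ∀ {a b c} → a ≡ c - b → a + b ≡ c
        a-b+b≡a {a} {b} {c} refl = cancel c b
          where
          cancel : ∀ c b → c - b + b ≡ c
          cancel = solve-∀

      shiftSum≡ : ∀ s → shiftSum c U s ≡ + q * periodSum U + Δ U′ s
      shiftSum≡ s = begin
        sumFin n (λ j → U (s ℕ.+ c j))                         ≡⟨ sum-cong (sumFin-linear n) (λ j → shift≡Δ-window U (c j) s) ⟩
        sumFin n (λ j → U s - Δ (window (c j) U) s)            ≡⟨ sum-- (sumFin-linear n) _ _ ⟩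
        sumFin n (λ _ → U s) - sumFin n (λ j → Δ (window (c j) U) s)
                                                               ≡⟨ cong₂ _-_ (sumFin-const n (U s)) (sym (Δ^-linear (sumFin-linear n) 1 (λ j → window (c j) U) s)) ⟩
        + n * U s - Δ cWindows s                               ≡⟨ cong (λ t → t * U s - Δ cWindows s) (trans (cong +_ n≡qp) (pos-* q p)) ⟩
        + q * + p * U s - Δ cWindows s                         ≡⟨ cong (λ t → t - Δ cWindows s) (trans (*-assoc (+ q) (+ p) (U s)) (cong (λ t → + q * t) (p*U≡ s))) ⟩
        + q * (periodSum U + Δ allWindows s) - Δ cWindows s    ≡⟨ regroup (+ q) (periodSum U) (allWindows s) (allWindows (suc s)) (cWindows s) (cWindows (suc s)) ⟩
        + q * periodSum U + Δ U′ s                             ∎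
        where
        regroup : ∀ q e a a′ b b′ → q * (e + (a - a′)) - (b - b′) ≡ q * e + ((q * a - b) - (q * a′ - b′))
        regroup = solve-∀

      U′-periodic : Periodic U′
      U′-periodic r = cong₂ (λ a b → + q * a - b)
        (sum-periodic (∑<-linear p) (λ r → window-periodic r U-per) r)
        (sum-periodic (sumFin-linear n) (λ j → window-periodic (c j) U-per) r)

      periodSum-U′ : periodSum U′ ≡ periodSum U * (balancedSum q - sumFin n (λ j → + c j))
      periodSum-U′ = begin
        ∑< p (λ s → + q * allWindows s - cWindows s)          ≡⟨ sum-- (∑<-linear p) _ _ ⟩
        ∑< p (λ s → + q * allWindows s) - periodSum cWindows  ≡⟨ cong₂ _-_ (sum-*ˡ (∑<-linear p) (+ q) allWindows) periodSum-cWindows ⟩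
        + q * periodSum allWindows - C * periodSum U          ≡⟨ cong (λ t → + q * t - C * periodSum U) periodSum-allWindows ⟩
        + q * (residueSum * periodSum U) - C * periodSum U    ≡⟨ factor (+ q) residueSum (periodSum U) C ⟩
        periodSum U * (balancedSum q - C)                     ∎
        where
        C = sumFin n (λ j → + c j)
        factor : ∀ q s e c → q * (s * e) - c * e ≡ e * (q * s - c)
        factor = solve-∀
        periodSum-allWindows : periodSum allWindows ≡ residueSum * periodSum U
        periodSum-allWindows =
          trans (∑<-fubini p (∑<-linear p) (λ s r → window r U s))
                (trans (sum-cong (∑<-linear p) (periodSum-window U-per)) (sum-*ʳ (∑<-linear p) (periodSum U) (λ r → + r)))
        periodSum-cWindows : periodSum cWindows ≡ C * periodSum U
        periodSum-cWindows =
          trans (sym (sumFin-fubini n (∑<-linear p) (λ j s → window (c j) U s)))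
                (trans (sum-cong (sumFin-linear n) (λ j → periodSum-window U-per (c j))) (sum-*ʳ (sumFin-linear n) (periodSum U) (λ j → + c j)))

    DiffForm-shiftSum : ∀ {n q} → n ≡ q ℕ.* p → (c : Fin n → ℕ) → ¬ (p∣ balancedSum q - sumFin n (λ j → + c j)) →
      ∀ m z → DiffForm m z → DiffForm (suc m) (shiftSum c z)
    DiffForm-shiftSum {n} {q} n≡qp c p∤ m z (U , K , U-per , z≡ , p∤U) = U′ , K′ , U′-periodic , shiftSum-z≡ , p∤U′
      where
      open ShiftSum {q = q} n≡qp c U-per
      open ≡-Reasoning
      C : ℤ
      C = Δ^ m (λ _ → + q * periodSum U) 0
      K′ : ℤ
      K′ = C + + n * K
      shiftSum-z≡ : ∀ r → shiftSum c z r ≡ Δ^ (suc m) U′ r + K′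
      shiftSum-z≡ r = begin
        sumFin n (λ j → z (r ℕ.+ c j))                               ≡⟨ sum-cong (sumFin-linear n) (λ j → z≡ (r ℕ.+ c j)) ⟩
        sumFin n (λ j → Δ^ m U (r ℕ.+ c j) + K)                      ≡⟨ sum-+ (sumFin-linear n) _ _ ⟩
        sumFin n (λ j → Δ^ m U (r ℕ.+ c j)) + sumFin n (λ _ → K)     ≡⟨ cong₂ _+_ (sum-cong (sumFin-linear n) (λ j → sym (Δ^-shift m U (c j) r))) (sumFin-const n K) ⟩
        sumFin n (λ j → Δ^ m (λ s → U (s ℕ.+ c j)) r) + + n * K      ≡⟨ cong (λ t → t + + n * K) (sym (Δ^-linear (sumFin-linear n) m (λ j s → U (s ℕ.+ c j)) r)) ⟩
        Δ^ m (shiftSum c U) r + + n * K                              ≡⟨ cong (λ t → t + + n * K) (Δ^-cong m shiftSum≡ r) ⟩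
        Δ^ m (λ s → + q * periodSum U + Δ U′ s) r + + n * K          ≡⟨ cong (λ t → t + + n * K) (Δ^-+ m _ (Δ U′) r) ⟩
        Δ^ m (λ _ → + q * periodSum U) r + Δ^ m (Δ U′) r + + n * K   ≡⟨ cong₂ (λ a b → a + b + + n * K) (Δ^-const m _ r) (Δ^-Δ m U′ r) ⟩
        C + Δ^ (suc m) U′ r + + n * K                                ≡⟨ regroup C (Δ^ (suc m) U′ r) (+ n * K) ⟩
        Δ^ (suc m) U′ r + K′                                         ∎
        where
        regroup : ∀ a b c → a + b + c ≡ b + (a + c)
        regroup = solve-∀
      p∤U′ : ¬ (p∣ periodSum U′)
      p∤U′ p∣U′ = [ p∤U , p∤ ]′ (p∣xy⇒p∣x⊎p∣y (periodSum U) (balancedSum q - sumFin n (λ j → + c j)) (subst p∣_ periodSum-U′ p∣U′))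

    δ : Seq
    δ r = 𝟙 (r % p ≡ᵇ 0)

    δ-periodic : Periodic δ
    δ-periodic r = cong (λ t → 𝟙 (t ≡ᵇ 0)) ([m+n]%n≡m%n r p)

    ∑<-δ : ∀ m → 1 ℕ.≤ m → m ℕ.≤ p → ∑< m δ ≡ + 1
    ∑<-δ (suc zero) _ _ = cong (λ t → + 0 + 𝟙 (t ≡ᵇ 0)) (m<n⇒m%n≡m {m = 0} (ℕ.>-nonZero⁻¹ p))
    ∑<-δ (suc (suc m)) _ 2+m≤p =
      trans (cong (λ t → ∑< (suc m) δ + 𝟙 (t ≡ᵇ 0)) (m<n⇒m%n≡m 2+m≤p))
            (trans (+-identityʳ _) (∑<-δ (suc m) (ℕ.s≤s ℕ.z≤n) (ℕ.<⇒≤ 2+m≤p)))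

    periodSum-δ : periodSum δ ≡ + 1
    periodSum-δ = ∑<-δ p (ℕ.>-nonZero⁻¹ p) ℕ.≤-refl

    p∤1 : ¬ (p∣ + 1)
    p∤1 p∣1 = ℕ.<-irrefl (sym (ℕ.∣1⇒≡1 (∣⇒∣ᵤ p∣1))) (ℕ.nonTrivial⇒n>1 p {{prime⇒nonTrivial p-prime}})

    DiffForm-δ : DiffForm 0 δ
    DiffForm-δ = δ , + 0 , δ-periodic , (λ r → sym (+-identityʳ (δ r))) , λ p∣δ → p∤1 (subst p∣_ periodSum-δ p∣δ)

  -- Residue counts and the dot product

  ≡ᵇ-true⇒≡ : ∀ x y → (x ≡ᵇ y) ≡ true → x ≡ y
  ≡ᵇ-true⇒≡ x y x≡ᵇy = ℕ.≡ᵇ⇒≡ x y (Equivalence.from T-≡ x≡ᵇy)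

  ≡ᵇ-refl : ∀ x → (x ≡ᵇ x) ≡ true
  ≡ᵇ-refl x = Equivalence.to T-≡ (ℕ.≡⇒≡ᵇ x x refl)

  ≢⇒≡ᵇ-false : ∀ {x y} → x ≢ y → (x ≡ᵇ y) ≡ false
  ≢⇒≡ᵇ-false {x} {y} x≢y with x ≡ᵇ y in x≡ᵇy
  ... | true = ⊥-elim (x≢y (≡ᵇ-true⇒≡ x y x≡ᵇy))
  ... | false = refl

  ∑<-select : ∀ m x (h : ℕ → ℤ) → x ℕ.< m → ∑< m (λ s → 𝟙 (x ≡ᵇ s) * h s) ≡ h x
  ∑<-select (suc m) x h x<1+m with x ℕ.≟ m
  ... | yes refl = begin
    ∑< m (λ s → 𝟙 (x ≡ᵇ s) * h s) + 𝟙 (x ≡ᵇ x) * h x  ≡⟨ cong₂ _+_ (∑<-select-none m ℕ.≤-refl) (cong (λ b → 𝟙 b * h x) (≡ᵇ-refl x)) ⟩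
    + 0 + + 1 * h x                                     ≡⟨ trans (+-identityˡ _) (*-identityˡ (h x)) ⟩
    h x                                                 ∎
    where
    open ≡-Reasoning
    ∑<-select-none : ∀ m → m ℕ.≤ x → ∑< m (λ s → 𝟙 (x ≡ᵇ s) * h s) ≡ + 0
    ∑<-select-none zero _ = refl
    ∑<-select-none (suc m) m<x = cong₂ _+_ (∑<-select-none m (ℕ.<⇒≤ m<x)) (cong (λ b → 𝟙 b * h m) (≢⇒≡ᵇ-false (ℕ.>⇒≢ m<x)))
  ... | no x≢m = begin
    ∑< m (λ s → 𝟙 (x ≡ᵇ s) * h s) + 𝟙 (x ≡ᵇ m) * h m  ≡⟨ cong₂ _+_ (∑<-select m x h (ℕ.≤∧≢⇒< (ℕ.≤-pred x<1+m) x≢m)) (cong (λ b → 𝟙 b * h m) (≢⇒≡ᵇ-false x≢m)) ⟩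
    h x + + 0 * h m                                     ≡⟨ trans (cong (λ t → h x + t) (*-zeroˡ (h m))) (+-identityʳ (h x)) ⟩
    h x                                                 ∎
    where open ≡-Reasoning

  module Residues (p : ℕ) {{_ : NonZero p}} where
    open PeriodicSequences p

    periodic-% : ∀ {z} → Periodic z → ∀ x → z x ≡ z (x % p)
    periodic-% {z} z-per x = trans (cong z (m≡m%n+[m/n]*n x p)) (go (x % p) (x / p))
      where
      go : ∀ y k → z (y ℕ.+ k ℕ.* p) ≡ z y
      go y zero = cong z (ℕ.+-identityʳ y)
      go y (suc k) = trans (cong z (+-more y k)) (trans (z-per (y ℕ.+ k ℕ.* p)) (go y k))
        where
        +-more : ∀ y k → y ℕ.+ suc k ℕ.* p ≡ y ℕ.+ k ℕ.* p ℕ.+ p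
        +-more y k = trans (cong (y ℕ.+_) (ℕ.+-comm p (k ℕ.* p))) (sym (ℕ.+-assoc y (k ℕ.* p) p))

    nonconstant⇒witness : ∀ {z} → Periodic z → ¬ (∀ r → z r ≡ z 0) → Σ[ r ∈ ℕ ] r ℕ.< p × z r ≢ z 0
    nonconstant⇒witness {z} z-per nonconstant with Fin.any? (λ (r : Fin p) → ¬? (z (toℕ r) ≟ z 0))
    ... | yes (r , zr≢z0) = toℕ r , Fin.toℕ<n r , zr≢z0
    ... | no none = ⊥-elim (nonconstant (λ r → trans (periodic-% z-per r) (constant-below (r % p) (m%n<n r p))))
      where
      constant-below : ∀ r → r ℕ.< p → z r ≡ z 0
      constant-below r r<p = subst (λ t → z t ≡ z 0) (Fin.toℕ-fromℕ< r<p)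
        (decidable-stable (z (toℕ (fromℕ< r<p)) ≟ z 0) (λ zr≢z0 → none (fromℕ< r<p , zr≢z0)))

    count : ∀ {n} → (Fin n → ℕ) → ℕ → ℤ
    count {n} c s = sumFin n (λ j → 𝟙 (c j % p ≡ᵇ s))

    sumFin-by-residue : ∀ {n} (c : Fin n → ℕ) (h : ℕ → ℤ) → sumFin n (λ j → h (c j % p)) ≡ ∑< p (λ s → count c s * h s)
    sumFin-by-residue {n} c h = begin
      sumFin n (λ j → h (c j % p))                           ≡⟨ sum-cong (sumFin-linear n) (λ j → sym (∑<-select p (c j % p) h (m%n<n (c j) p))) ⟩
      sumFin n (λ j → ∑< p (λ s → 𝟙 (c j % p ≡ᵇ s) * h s))   ≡⟨ sumFin-fubini n (∑<-linear p) (λ j s → 𝟙 (c j % p ≡ᵇ s) * h s) ⟩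
      ∑< p (λ s → sumFin n (λ j → 𝟙 (c j % p ≡ᵇ s) * h s))   ≡⟨ sum-cong (∑<-linear p) (λ s → sum-*ʳ (sumFin-linear n) (h s) (λ j → 𝟙 (c j % p ≡ᵇ s))) ⟩
      ∑< p (λ s → count c s * h s)                           ∎
      where open ≡-Reasoning

    sumFin-periodic-by-residue : ∀ {n} {z} → Periodic z → (c : Fin n → ℕ) → sumFin n (λ j → z (c j)) ≡ ∑< p (λ s → count c s * z s)
    sumFin-periodic-by-residue {n} z-per c = trans (sum-cong (sumFin-linear n) (λ j → periodic-% z-per (c j))) (sumFin-by-residue c _)

    ∑<-count : ∀ {n} (c : Fin n → ℕ) → ∑< p (count c) ≡ + n
    ∑<-count {n} c = begin
      ∑< p (count c)                          ≡⟨ sum-cong (∑<-linear p) (λ s → sym (*-identityʳ (count c s))) ⟩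
      ∑< p (λ s → count c s * + 1)            ≡⟨ sym (sumFin-by-residue c (λ _ → + 1)) ⟩
      sumFin n (λ _ → + 1)                    ≡⟨ sumFin-const n (+ 1) ⟩
      + n * + 1                               ≡⟨ *-identityʳ (+ n) ⟩
      + n                                     ∎
      where open ≡-Reasoning

    [x+y%p]%p≡[x+y]%p : ∀ x y → (x ℕ.+ y % p) % p ≡ (x ℕ.+ y) % p
    [x+y%p]%p≡[x+y]%p x y = begin
      (x ℕ.+ y % p) % p            ≡⟨ %-distribˡ-+ x (y % p) p ⟩
      (x % p ℕ.+ y % p % p) % p    ≡⟨ cong (λ t → (x % p ℕ.+ t) % p) (m%n%n≡m%n y p) ⟩
      (x % p ℕ.+ y % p) % p        ≡⟨ sym (%-distribˡ-+ x y p) ⟩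
      (x ℕ.+ y) % p                ∎
      where open ≡-Reasoning

    ωpow≡indicators : ∀ m (i : Fin (p ∸ 1)) → ωpow p m i ≡ 𝟙 (m % p ≡ᵇ toℕ i) - 𝟙 (m % p ≡ᵇ (p ∸ 1))
    ωpow≡indicators m i with m % p ≡ᵇ toℕ i in m≡i | m % p ≡ᵇ (p ∸ 1) in m≡p-1
    ... | true | true = ⊥-elim (ℕ.<-irrefl (trans (sym (≡ᵇ-true⇒≡ (m % p) _ m≡i)) (≡ᵇ-true⇒≡ (m % p) _ m≡p-1)) (Fin.toℕ<n i))
    ... | true | false = refl
    ... | false | true = refl
    ... | false | false = refl

    equal-counts⇒balanced : ∀ {n q} → n ≡ q ℕ.* p → (c : Fin n → ℕ) →
      (∀ (i : Fin (p ∸ 1)) → count c (toℕ i) - count c (p ∸ 1) ≡ + 0) → ∀ s → s ℕ.< p → count c s ≡ + q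
    equal-counts⇒balanced {n} {q} n≡qp c same-count s s<p = trans (count≡last s s<p) last≡q
      where
      open ≡-Reasoning
      count≡last : ∀ s → s ℕ.< p → count c s ≡ count c (p ∸ 1)
      count≡last s s<p with s ℕ.<? p ∸ 1
      ... | yes s<p-1 = trans (cong (count c) (sym (Fin.toℕ-fromℕ< s<p-1)))
                              (i-j≡0⇒i≡j _ _ (same-count (fromℕ< s<p-1)))
      ... | no s≮p-1 = cong (count c) (ℕ.≤-antisym (ℕ.≤-pred (ℕ.≤-trans s<p (ℕ.≤-reflexive (sym (ℕ.suc-pred p))))) (ℕ.≮⇒≥ s≮p-1))
      last≡q : count c (p ∸ 1) ≡ + q
      last≡q = *-cancelˡ-≡ (+ p) _ _ (begin
        + p * count c (p ∸ 1)       ≡⟨ sym (∑<-const p _) ⟩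
        ∑< p (λ _ → count c (p ∸ 1)) ≡⟨ ∑<-cong-< p (λ s s<p → sym (count≡last s s<p)) ⟩
        ∑< p (count c)              ≡⟨ ∑<-count c ⟩
        + n                         ≡⟨ trans (cong +_ (trans n≡qp (ℕ.*-comm q p))) (pos-* p q) ⟩
        + p * + q                   ∎)

    toB : ∀ {n} → Vec ℕ n → B n p
    toB b j = fromℕ< (m%n<n (lookup b j) p)

    residues : ∀ {n} → B n p → Vec ℕ n → Fin n → ℕ
    residues a b j = toℕ (a j) ℕ.+ lookup b j

    dot-toB : ∀ {n} (a : B n p) (b : Vec ℕ n) i →
      dot n p a (toB b) i ≡ count (residues a b) (toℕ i) - count (residues a b) (p ∸ 1)
    dot-toB {n} a b i = trans (sum-cong (sumFin-linear n) ωpow-residue) (sum-- (sumFin-linear n) _ _)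
      where
      ωpow-residue : ∀ j → ωpow p (toℕ (a j) ℕ.+ toℕ (toB b j)) i ≡ 𝟙 (residues a b j % p ≡ᵇ toℕ i) - 𝟙 (residues a b j % p ≡ᵇ (p ∸ 1))
      ωpow-residue j = trans (ωpow≡indicators _ i) (cong (λ t → 𝟙 (t ≡ᵇ toℕ i) - 𝟙 (t ≡ᵇ (p ∸ 1)))
        (trans (cong (λ t → (toℕ (a j) ℕ.+ t) % p) (Fin.toℕ-fromℕ< (m%n<n (lookup b j) p))) ([x+y%p]%p≡[x+y]%p (toℕ (a j)) (lookup b j))))

  -- Sums over the box [0, p)ⁿ and congruences modulo p

  vecSum : ∀ {m} → Vec ℕ m → ℤ
  vecSum {m} b = sumFin m (λ j → + lookup b j)

  pathShift : ∀ {n} → Vec ℕ n → ∀ {m} → Vec (Fin n) m → ℕ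
  pathShift τ [] = 0
  pathShift τ (j ∷ φ) = lookup τ j ℕ.+ pathShift τ φ

  module Boxes (p : ℕ) {{_ : NonZero p}} where
    open PeriodicSequences p

    ∑Box : (m : ℕ) → (Vec ℕ m → ℤ) → ℤ
    ∑Box zero f = f []
    ∑Box (suc m) f = ∑< p (λ x → ∑Box m (λ b → f (x ∷ b)))

    ∑Box-linear : ∀ m → IsLinearSum (∑Box m)
    ∑Box-linear zero = record { sum-cong = λ e → e [] ; sum-+ = λ f g → refl ; sum-*ˡ = λ c f → refl ; sum-nonneg = λ f f≥0 → f≥0 [] }
    ∑Box-linear (suc m) = nested-linear (∑<-linear p) (∑Box-linear m) _∷_

    ∑Box-fubini : ∀ m → Fubini (∑Box m)
    ∑Box-fubini zero T-lin f = refl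
    ∑Box-fubini (suc m) = nested-fubini {T = ∑Box m} (∑<-linear p) (∑<-fubini p) (∑Box-fubini m) _∷_

    ∑Box-term≤ : ∀ m (f : Vec ℕ m → ℤ) → (∀ b → + 0 ≤ f b) → ∀ {b} → AllVec (ℕ._< p) b → f b ≤ ∑Box m f
    ∑Box-term≤ zero f f≥0 [] = ≤-refl
    ∑Box-term≤ (suc m) f f≥0 {x ∷ b} (x<p ∷ b<p) =
      ≤-trans (∑Box-term≤ m (λ b → f (x ∷ b)) (λ b → f≥0 (x ∷ b)) b<p)
              (∑<-term≤ p (λ x → ∑Box m (λ b → f (x ∷ b))) x (λ y → sum-nonneg (∑Box-linear m) _ (λ b → f≥0 (y ∷ b))) x<p)

    ∑<-rotate : ∀ (h : ℕ → ℤ) y → ∑< p (λ x → h ((x ℕ.+ y) % p)) ≡ ∑< p h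
    ∑<-rotate h y = begin
      ∑< p (λ x → h′ (x ℕ.+ y))   ≡⟨ sum-cong (∑<-linear p) (λ x → cong h′ (ℕ.+-comm x y)) ⟩
      ∑< p (λ x → h′ (y ℕ.+ x))   ≡⟨ periodSum-from h′-periodic y ⟩
      ∑< p h′                     ≡⟨ ∑<-cong-< p (λ x x<p → cong h (m<n⇒m%n≡m x<p)) ⟩
      ∑< p h                      ∎
      where
      open ≡-Reasoning
      h′ : ℕ → ℤ
      h′ t = h (t % p)
      h′-periodic : Periodic h′
      h′-periodic r = cong h ([m+n]%n≡m%n r p)

    infixl 6 _⊕_
    _⊕_ : ∀ {m} → Vec ℕ m → Vec ℕ m → Vec ℕ m
    [] ⊕ [] = []
    (x ∷ b) ⊕ (y ∷ τ) = (x ℕ.+ y) % p ∷ b ⊕ τ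

    lookup-⊕ : ∀ {m} (b τ : Vec ℕ m) j → lookup (b ⊕ τ) j ≡ (lookup b j ℕ.+ lookup τ j) % p
    lookup-⊕ (x ∷ b) (y ∷ τ) fzero = refl
    lookup-⊕ (x ∷ b) (y ∷ τ) (fsuc j) = lookup-⊕ b τ j

    ∑Box-translate : ∀ m (f : Vec ℕ m → ℤ) (τ : Vec ℕ m) → ∑Box m (λ b → f (b ⊕ τ)) ≡ ∑Box m f
    ∑Box-translate zero f [] = refl
    ∑Box-translate (suc m) f (y ∷ τ) =
      trans (sum-cong (∑<-linear p) (λ x → ∑Box-translate m (λ b → f ((x ℕ.+ y) % p ∷ b)) τ))
            (∑<-rotate (λ x → ∑Box m (λ b → f (x ∷ b))) y)

  module Congruence (p : ℕ) {{_ : NonZero p}} where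
    open PeriodicSequences p

    infix 4 _≈_
    _≈_ : ℕ → ℕ → Set
    x ≈ y = x % p ≡ y % p

    ≈-+ : ∀ {x x′ y y′} → x ≈ x′ → y ≈ y′ → x ℕ.+ y ≈ x′ ℕ.+ y′
    ≈-+ {x} {x′} {y} {y′} x≈x′ y≈y′ =
      trans (%-distribˡ-+ x y p) (trans (cong₂ (λ s t → (s ℕ.+ t) % p) x≈x′ y≈y′) (sym (%-distribˡ-+ x′ y′ p)))

    %-≈ : ∀ x → x % p ≈ x
    %-≈ x = m%n%n≡m%n x p

    ≈⇒p∣- : ∀ x y → x ≈ y → p∣ + x - + y
    ≈⇒p∣- x y x≈y = divides (+ (x / p) - + (y / p)) (begin
      + x - + y                                     ≡⟨ cong₂ (λ a b → + a - + b) (m≡m%n+[m/n]*n x p) (m≡m%n+[m/n]*n y p) ⟩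
      + (x % p ℕ.+ x / p ℕ.* p) - + (y % p ℕ.+ y / p ℕ.* p)
                                                    ≡⟨ cong₂ _-_ (pos-+-* (x % p) (x / p)) (pos-+-* (y % p) (y / p)) ⟩
      (+ (x % p) + + (x / p) * + p) - (+ (y % p) + + (y / p) * + p)
                                                    ≡⟨ cong (λ t → (+ (x % p) + + (x / p) * + p) - (+ t + + (y / p) * + p)) (sym x≈y) ⟩
      (+ (x % p) + + (x / p) * + p) - (+ (x % p) + + (y / p) * + p)
                                                    ≡⟨ factor (+ (x % p)) (+ (x / p)) (+ (y / p)) (+ p) ⟩
      (+ (x / p) - + (y / p)) * + p                 ∎)
      where
      open ≡-Reasoning
      pos-+-* : ∀ r k → + (r ℕ.+ k ℕ.* p) ≡ + r + + k * + p
      pos-+-* r k = trans (pos-+ r (k ℕ.* p)) (cong (λ t → + r + t) (pos-* k p))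
      factor : ∀ a b c q → (a + b * q) - (a + c * q) ≡ (b - c) * q
      factor = solve-∀

    private
      p∣-⇒≈-≥ : ∀ {x y} → y ℕ.≤ x → p∣ + x - + y → x ≈ y
      p∣-⇒≈-≥ {x} {y} y≤x p∣x-y = begin
        x % p                  ≡⟨ cong (_% p) (sym (ℕ.m+[n∸m]≡n y≤x)) ⟩
        (y ℕ.+ (x ∸ y)) % p    ≡⟨ %-remove-+ʳ y (∣⇒∣ᵤ (subst p∣_ (trans (m-n≡m⊖n x y) (⊖-≥ y≤x)) p∣x-y)) ⟩
        y % p                  ∎
        where open ≡-Reasoning

    p∣-⇒≈ : ∀ x y → p∣ + x - + y → x ≈ y
    p∣-⇒≈ x y p∣x-y with ℕ.≤-total y x
    ... | inj₁ y≤x = p∣-⇒≈-≥ y≤x p∣x-y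
    ... | inj₂ x≤y = sym (p∣-⇒≈-≥ x≤y (subst p∣_ (neg-minus (+ x) (+ y)) (∣m⇒∣-m p∣x-y)))
      where
      neg-minus : ∀ a b → - (a - b) ≡ b - a
      neg-minus = solve-∀

    p∣-sumFin : ∀ m (f : Fin m → ℤ) → (∀ j → p∣ f j) → p∣ sumFin m f
    p∣-sumFin zero f p∣f = divides (+ 0) refl
    p∣-sumFin (suc m) f p∣f = ∣m∣n⇒∣m+n (p∣f fzero) (p∣-sumFin m (λ j → f (fsuc j)) (λ j → p∣f (fsuc j)))

    residue-unique : ∀ X {u u′} → u ℕ.< p → u′ ℕ.< p → p∣ X + + u → p∣ X + + u′ → u ≡ u′
    residue-unique X {u} {u′} u<p u′<p p∣X+u p∣X+u′ = subst₂ _≡_ (m<n⇒m%n≡m u<p) (m<n⇒m%n≡m u′<p)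
      (p∣-⇒≈ u u′ (subst p∣_ (cancel X (+ u) (+ u′)) (∣m∣n⇒∣m-n p∣X+u p∣X+u′)))
      where
      cancel : ∀ X u u′ → X + u - (X + u′) ≡ u - u′
      cancel = solve-∀

    p∣-⇔ : ∀ A B → p∣ A - B → p∣ A ⇔ p∣ B
    p∣-⇔ A B p∣A-B = mk⇔ (λ p∣A → subst p∣_ (cancelˡ A B) (∣m∣n⇒∣m-n p∣A p∣A-B))
                          (λ p∣B → subst p∣_ (cancelʳ A B) (∣m∣n⇒∣m+n p∣A-B p∣B))
      where
      cancelˡ : ∀ A B → A - (A - B) ≡ B
      cancelˡ = solve-∀
      cancelʳ : ∀ A B → A - B + B ≡ A
      cancelʳ = solve-∀

    p∣x%ℕp-x : ∀ x → p∣ + (x %ℕ p) - x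
    p∣x%ℕp-x x = divides (- (x /ℕ p)) (remainder {x} {x %ℕ p} {x /ℕ p} (a≡a%ℕn+[a/ℕn]*n x p))
      where
      remainder : ∀ {x u k} → x ≡ + u + k * + p → + u - x ≡ - k * + p
      remainder {x} {u} {k} refl = cancel (+ u) k (+ p)
        where
        cancel : ∀ u k q → u - (u + k * q) ≡ - k * q
        cancel = solve-∀

    Translation : ∀ {n m} → (φ ψ : Vec (Fin n) m) → Set
    Translation {n} φ ψ = Σ[ τ ∈ Vec ℕ n ] p∣ vecSum τ - + 1 × pathShift τ φ ≈ pathShift τ ψ

    Translatable : ℕ → ℕ → Set
    Translatable n m = (φ ψ : Vec (Fin n) m) → Translation φ ψ

  does-⇔ : ∀ {A B : Set} → A ⇔ B → (a? : Dec A) (b? : Dec B) → does a? ≡ does b?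
  does-⇔ A⇔B (yes a) b? = sym (dec-true b? (Equivalence.to A⇔B a))
  does-⇔ A⇔B (no ¬a) b? = sym (dec-false b? (λ b → ¬a (Equivalence.from A⇔B b)))

  -- Path counts and their energy

  square-nonneg : ∀ x → + 0 ≤ x * x
  square-nonneg (+ zero) = +≤+ ℕ.z≤n
  square-nonneg +[1+ k ] = +≤+ ℕ.z≤n
  square-nonneg -[1+ k ] = +≤+ ℕ.z≤n

  square-pos : ∀ x → x ≢ + 0 → + 0 < x * x
  square-pos (+ zero) x≢0 = ⊥-elim (x≢0 refl)
  square-pos +[1+ k ] x≢0 = +<+ (ℕ.s≤s ℕ.z≤n)
  square-pos -[1+ k ] x≢0 = +<+ (ℕ.s≤s ℕ.z≤n)

  ∑<-squared-differences : ∀ m (a : ℕ → ℤ) →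
    ∑< m (λ r → ∑< m (λ r′ → (a r - a r′) * (a r - a r′))) ≡ + 2 * (+ m * ∑< m (λ r → a r * a r) - ∑< m a * ∑< m a)
  ∑<-squared-differences m a = begin
    ∑< m (λ r → ∑< m (λ r′ → (a r - a r′) * (a r - a r′)))  ≡⟨ sum-cong (∑<-linear m) inner ⟩
    ∑< m (λ r → + m * (a r * a r) + S₂ - + 2 * (a r * S₁))  ≡⟨ sum-- (∑<-linear m) _ _ ⟩
    ∑< m (λ r → + m * (a r * a r) + S₂) - ∑< m (λ r → + 2 * (a r * S₁))
        ≡⟨ cong₂ _-_ (trans (sum-+ (∑<-linear m) _ _) (cong₂ _+_ (sum-*ˡ (∑<-linear m) (+ m) (λ r → a r * a r)) (∑<-const m S₂)))
                     (trans (sum-*ˡ (∑<-linear m) (+ 2) _) (cong (λ t → + 2 * t) (sum-*ʳ (∑<-linear m) S₁ a))) ⟩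
    + m * S₂ + + m * S₂ - + 2 * (S₁ * S₁)                   ≡⟨ double (+ m) S₂ S₁ ⟩
    + 2 * (+ m * S₂ - S₁ * S₁)                              ∎
    where
    open ≡-Reasoning
    S₁ S₂ : ℤ
    S₁ = ∑< m a
    S₂ = ∑< m (λ r → a r * a r)
    double : ∀ m s t → m * s + m * s - + 2 * (t * t) ≡ + 2 * (m * s - t * t)
    double = solve-∀
    expand : ∀ x y → (x - y) * (x - y) ≡ x * x + y * y - + 2 * (x * y)
    expand = solve-∀
    inner : ∀ r → ∑< m (λ r′ → (a r - a r′) * (a r - a r′)) ≡ + m * (a r * a r) + S₂ - + 2 * (a r * S₁)
    inner r = begin
      ∑< m (λ r′ → (a r - a r′) * (a r - a r′))                                 ≡⟨ sum-cong (∑<-linear m) (λ r′ → expand (a r) (a r′)) ⟩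
      ∑< m (λ r′ → a r * a r + a r′ * a r′ - + 2 * (a r * a r′))                ≡⟨ sum-- (∑<-linear m) _ _ ⟩
      ∑< m (λ r′ → a r * a r + a r′ * a r′) - ∑< m (λ r′ → + 2 * (a r * a r′))
          ≡⟨ cong₂ _-_ (trans (sum-+ (∑<-linear m) _ _) (cong (_+ S₂) (∑<-const m (a r * a r))))
                       (trans (sum-*ˡ (∑<-linear m) (+ 2) _) (cong (λ t → + 2 * t) (sum-*ˡ (∑<-linear m) (a r) a))) ⟩
      + m * (a r * a r) + S₂ - + 2 * (a r * S₁)                                 ∎

  module Paths (p : ℕ) {{_ : NonZero p}} (p-prime : Prime p) {n q : ℕ} (n≡qp : n ≡ q ℕ.* p) where
    open PeriodicSequences p
    open Convolution p p-prime
    open Residues p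

    ∑Path : (m : ℕ) → (Vec (Fin n) m → ℤ) → ℤ
    ∑Path zero f = f []
    ∑Path (suc m) f = sumFin n (λ j → ∑Path m (λ φ → f (j ∷ φ)))

    ∑Path-linear : ∀ m → IsLinearSum (∑Path m)
    ∑Path-linear zero = record { sum-cong = λ e → e [] ; sum-+ = λ f g → refl ; sum-*ˡ = λ c f → refl ; sum-nonneg = λ f f≥0 → f≥0 [] }
    ∑Path-linear (suc m) = nested-linear (sumFin-linear n) (∑Path-linear m) _∷_

    pathValue : (L : List (B n p)) → Vec (Fin n) (length L) → Vec ℕ n → ℕ
    pathValue [] [] b = 0
    pathValue (a ∷ L) (j ∷ φ) b = residues a b j ℕ.+ pathValue L φ b

    -- pathCount L b r counts the paths of value ≡ -r (mod p): it is the coefficient sequence of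
    -- the product over a ∈ L of the group-ring elements Σⱼ X^(residues a b j) in ℤ[X]/(Xᵖ - 1).
    pathCount : List (B n p) → Vec ℕ n → Seq
    pathCount L b r = ∑Path (length L) (λ φ → δ (pathValue L φ b ℕ.+ r))

    pathCount-∷ : ∀ a L b → pathCount (a ∷ L) b ≗ shiftSum (residues a b) (pathCount L b)
    pathCount-∷ a L b r = sum-cong (sumFin-linear n) (λ j → sum-cong (∑Path-linear (length L))
      (λ φ → cong δ (reassoc (residues a b j) (pathValue L φ b) r)))
      where
      reassoc : ∀ c v r → c ℕ.+ v ℕ.+ r ≡ v ℕ.+ (r ℕ.+ c)
      reassoc = ℕ-Solver.solve-∀

    δ-shift-periodic : ∀ x → Periodic (λ r → δ (x ℕ.+ r))
    δ-shift-periodic x r = trans (cong δ (sym (ℕ.+-assoc x r p))) (δ-periodic (x ℕ.+ r))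

    pathCount-periodic : ∀ L b → Periodic (pathCount L b)
    pathCount-periodic L b = sum-periodic (∑Path-linear (length L)) (λ φ → δ-shift-periodic (pathValue L φ b))

    Compatible : B n p → Vec ℕ n → Set
    Compatible a b = p∣ balancedSum q - sumFin n (λ j → + residues a b j)

    DiffForm-pathCount : ∀ L b → All (λ a → ¬ Compatible a b) L → DiffForm (length L) (pathCount L b)
    DiffForm-pathCount [] b [] = DiffForm-δ
    DiffForm-pathCount (a ∷ L) b (incompatible ∷ rest) = DiffForm-cong (suc (length L)) (λ r → sym (pathCount-∷ a L b r))
      (DiffForm-shiftSum {q = q} n≡qp (residues a b) incompatible (length L) (pathCount L b) (DiffForm-pathCount L b rest))

    Covers : B n p → Vec ℕ n → Set
    Covers a b = IsZero p (dot n p a (toB b))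

    covers⇒balanced : ∀ a b → Covers a b → ∀ s → s ℕ.< p → count (residues a b) s ≡ + q
    covers⇒balanced a b a-covers = equal-counts⇒balanced {q = q} n≡qp (residues a b) (λ i → trans (sym (dot-toB {n} a b i)) (a-covers i))

    covered⇒pathCount-constant : ∀ {L b} → Any (λ a → Covers a b) L → ∀ r → pathCount L b r ≡ pathCount L b 0
    covered⇒pathCount-constant {a ∷ L} {b} (here a-covers) r = trans (pathCount≡ r) (sym (pathCount≡ 0))
      where
      pathCount≡ : ∀ r → pathCount (a ∷ L) b r ≡ + q * periodSum (pathCount L b)
      pathCount≡ r = begin
        pathCount (a ∷ L) b r                        ≡⟨ pathCount-∷ a L b r ⟩
        sumFin n (λ j → z (residues a b j))          ≡⟨ sumFin-periodic-by-residue z-periodic (residues a b) ⟩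
        ∑< p (λ s → count (residues a b) s * z s)    ≡⟨ ∑<-cong-< p (λ s s<p → cong (_* z s) (covers⇒balanced a b a-covers s s<p)) ⟩
        ∑< p (λ s → + q * z s)                       ≡⟨ sum-*ˡ (∑<-linear p) (+ q) z ⟩
        + q * ∑< p z                                 ≡⟨ cong (λ t → + q * t) (periodSum-from (pathCount-periodic L b) r) ⟩
        + q * periodSum (pathCount L b)              ∎
        where
        open ≡-Reasoning
        z : Seq
        z x = pathCount L b (r ℕ.+ x)
        z-periodic : Periodic z
        z-periodic x = trans (cong (pathCount L b) (sym (ℕ.+-assoc r x p))) (pathCount-periodic L b (r ℕ.+ x))
    covered⇒pathCount-constant {a ∷ L} {b} (there covered) r = begin
      pathCount (a ∷ L) b r                                      ≡⟨ pathCount-∷ a L b r ⟩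
      sumFin n (λ j → pathCount L b (r ℕ.+ residues a b j))      ≡⟨ sum-cong (sumFin-linear n) (λ j → constant (r ℕ.+ residues a b j)) ⟩
      sumFin n (λ j → pathCount L b 0)                           ≡⟨ sum-cong (sumFin-linear n) (λ j → sym (constant (residues a b j))) ⟩
      sumFin n (λ j → pathCount L b (0 ℕ.+ residues a b j))      ≡⟨ sym (pathCount-∷ a L b 0) ⟩
      pathCount (a ∷ L) b 0                                      ∎
      where
      open ≡-Reasoning
      constant : ∀ r → pathCount L b r ≡ pathCount L b 0
      constant = covered⇒pathCount-constant covered

  module Energy (p : ℕ) {{_ : NonZero p}} (p-prime : Prime p) {n q : ℕ} (n≡qp : n ≡ q ℕ.* p) where
    open PeriodicSequences p
    open Convolution p p-prime
    open Paths p p-prime {q = q} n≡qp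

    coincidence : ℕ → ℕ → ℤ
    coincidence x y = ∑< p (λ r → δ (x ℕ.+ r) * δ (y ℕ.+ r))

    pairTerm : (L : List (B n p)) → (φ ψ : Vec (Fin n) (length L)) → Vec ℕ n → ℤ
    pairTerm L φ ψ b = + p * coincidence (pathValue L φ b) (pathValue L ψ b) - + 1

    energy : List (B n p) → Vec ℕ n → ℤ
    energy L b = ∑Path (length L) (λ φ → ∑Path (length L) (λ ψ → pairTerm L φ ψ b))

    module _ (L : List (B n p)) (b : Vec ℕ n) where
      private
        m = length L
        F = pathCount L b
        v : Vec (Fin n) m → ℕ
        v φ = pathValue L φ b
        paths : ℤ
        paths = ∑Path m (λ _ → + 1)
        Path = ∑Path-linear m

      ∑<-pathCount² : ∑< p (λ r → F r * F r) ≡ ∑Path m (λ φ → ∑Path m (λ ψ → coincidence (v φ) (v ψ)))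
      ∑<-pathCount² = begin
        ∑< p (λ r → F r * F r)
          ≡⟨ sum-cong (∑<-linear p) (λ r → trans (sym (sum-*ʳ Path (F r) (λ φ → δ (v φ ℕ.+ r))))
                                                 (sum-cong Path (λ φ → sym (sum-*ˡ Path (δ (v φ ℕ.+ r)) (λ ψ → δ (v ψ ℕ.+ r)))))) ⟩
        ∑< p (λ r → ∑Path m (λ φ → ∑Path m (λ ψ → δ (v φ ℕ.+ r) * δ (v ψ ℕ.+ r))))
          ≡⟨ ∑<-fubini p Path (λ r φ → ∑Path m (λ ψ → δ (v φ ℕ.+ r) * δ (v ψ ℕ.+ r))) ⟩
        ∑Path m (λ φ → ∑< p (λ r → ∑Path m (λ ψ → δ (v φ ℕ.+ r) * δ (v ψ ℕ.+ r))))
          ≡⟨ sum-cong Path (λ φ → ∑<-fubini p Path (λ r ψ → δ (v φ ℕ.+ r) * δ (v ψ ℕ.+ r))) ⟩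
        ∑Path m (λ φ → ∑Path m (λ ψ → coincidence (v φ) (v ψ)))
          ∎
        where open ≡-Reasoning

      ∑<-pathCount : ∑< p F ≡ paths
      ∑<-pathCount = trans (∑<-fubini p Path (λ r φ → δ (v φ ℕ.+ r)))
        (sum-cong Path (λ φ → trans (periodSum-from δ-periodic (v φ)) periodSum-δ))

      energy≡ : energy L b ≡ + p * ∑Path m (λ φ → ∑Path m (λ ψ → coincidence (v φ) (v ψ))) - paths * paths
      energy≡ = begin
        ∑Path m (λ φ → ∑Path m (λ ψ → + p * coincidence (v φ) (v ψ) - + 1))
          ≡⟨ sum-cong Path (λ φ → sum-- Path _ _) ⟩
        ∑Path m (λ φ → ∑Path m (λ ψ → + p * coincidence (v φ) (v ψ)) - paths)
          ≡⟨ sum-- Path _ _ ⟩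
        ∑Path m (λ φ → ∑Path m (λ ψ → + p * coincidence (v φ) (v ψ))) - ∑Path m (λ _ → paths)
          ≡⟨ cong₂ _-_ (trans (sum-cong Path (λ φ → sum-*ˡ Path (+ p) _)) (sum-*ˡ Path (+ p) _))
                       (trans (sum-cong Path (λ _ → sym (*-identityʳ paths))) (sum-*ˡ Path paths (λ _ → + 1))) ⟩
        + p * ∑Path m (λ φ → ∑Path m (λ ψ → coincidence (v φ) (v ψ))) - paths * paths
          ∎
        where open ≡-Reasoning

      2*energy≡ : + 2 * energy L b ≡ ∑< p (λ r → ∑< p (λ r′ → (F r - F r′) * (F r - F r′)))
      2*energy≡ = sym (begin
        ∑< p (λ r → ∑< p (λ r′ → (F r - F r′) * (F r - F r′)))  ≡⟨ ∑<-squared-differences p F ⟩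
        + 2 * (+ p * ∑< p (λ r → F r * F r) - ∑< p F * ∑< p F)  ≡⟨ cong₂ (λ s t → + 2 * (+ p * s - t * t)) ∑<-pathCount² ∑<-pathCount ⟩
        + 2 * (+ p * ∑Path m (λ φ → ∑Path m (λ ψ → coincidence (v φ) (v ψ))) - paths * paths)
                                                                ≡⟨ cong (λ t → + 2 * t) (sym energy≡) ⟩
        + 2 * energy L b                                        ∎)
        where open ≡-Reasoning

      energy-nonneg : + 0 ≤ energy L b
      energy-nonneg = *-cancelˡ-≤-pos (+ 0) (energy L b) (+ 2) (≤-trans
        (sum-nonneg (∑<-linear p) _ (λ r → sum-nonneg (∑<-linear p) _ (λ r′ → square-nonneg (F r - F r′))))
        (≤-reflexive (sym 2*energy≡)))

      nonconstant⇒energy-pos : ∀ r → r ℕ.< p → F r ≢ F 0 → + 0 < energy L b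
      nonconstant⇒energy-pos r r<p Fr≢F0 = *-cancelˡ-<-nonNeg (+ 2) (<-≤-trans (square-pos (F r - F 0) Fr-F0≢0) (begin
        (F r - F 0) * (F r - F 0)                               ≤⟨ ∑<-term≤ p (λ r′ → (F r - F r′) * (F r - F r′)) 0 (λ r′ → square-nonneg (F r - F r′)) (ℕ.>-nonZero⁻¹ p) ⟩
        ∑< p (λ r′ → (F r - F r′) * (F r - F r′))               ≤⟨ ∑<-term≤ p (λ r₁ → ∑< p (λ r′ → (F r₁ - F r′) * (F r₁ - F r′))) r
                                                                     (λ r₁ → sum-nonneg (∑<-linear p) _ (λ r′ → square-nonneg (F r₁ - F r′))) r<p ⟩
        ∑< p (λ r → ∑< p (λ r′ → (F r - F r′) * (F r - F r′)))  ≡⟨ sym 2*energy≡ ⟩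
        + 2 * energy L b                                        ∎))
        where
        open ≤-Reasoning
        Fr-F0≢0 : F r - F 0 ≢ + 0
        Fr-F0≢0 Fr-F0≡0 = Fr≢F0 (i-j≡0⇒i≡j (F r) (F 0) Fr-F0≡0)

      constant⇒energy-zero : (∀ r → F r ≡ F 0) → energy L b ≡ + 0
      constant⇒energy-zero F-const = *-cancelˡ-≡ (+ 2) (energy L b) (+ 0) (trans 2*energy≡ (trans
        (sum-cong (∑<-linear p) (λ r → sum-cong (∑<-linear p) (λ r′ →
          cong (λ t → t * t) (trans (cong₂ _-_ (F-const r) (F-const r′)) (+-inverseʳ (F 0))))))
        (trans (sum-cong (∑<-linear p) (λ r → sum-zero (∑<-linear p))) (sum-zero (∑<-linear p)))))

  -- Class energies

  module Classes (p : ℕ) {{_ : NonZero p}} (p-prime : Prime p) {n q : ℕ} (n≡qp : n ≡ q ℕ.* p) where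
    open PeriodicSequences p
    open Convolution p p-prime
    open Residues p
    open Boxes p
    open Congruence p
    open Paths p p-prime {q = q} n≡qp
    open Energy p p-prime {q = q} n≡qp

    expSum : B n p → ℤ
    expSum a = sumFin n (λ j → + toℕ (a j))

    sumFin-residues : ∀ a b → sumFin n (λ j → + residues a b j) ≡ expSum a + vecSum b
    sumFin-residues a b = trans (sum-cong (sumFin-linear n) (λ j → pos-+ (toℕ (a j)) (lookup b j)))
                                (sum-+ (sumFin-linear n) (λ j → + toℕ (a j)) (λ j → + lookup b j))

    covers⇒compatible : ∀ a b → Covers a b → Compatible a b
    covers⇒compatible a b a-covers = subst p∣_ (neg-minus (sumFin n (λ j → + c j)) (sumFin n (λ j → + (c j % p))) _ balanced) (∣m⇒∣-m p∣c-c%p)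
      where
      c = residues a b
      balanced : sumFin n (λ j → + (c j % p)) ≡ balancedSum q
      balanced = begin
        sumFin n (λ j → + (c j % p))    ≡⟨ sumFin-by-residue c (λ s → + s) ⟩
        ∑< p (λ s → count c s * + s)    ≡⟨ ∑<-cong-< p (λ s s<p → cong (λ t → t * + s) (covers⇒balanced a b a-covers s s<p)) ⟩
        ∑< p (λ s → + q * + s)          ≡⟨ sum-*ˡ (∑<-linear p) (+ q) (λ s → + s) ⟩
        balancedSum q                   ∎
        where open ≡-Reasoning
      p∣c-c%p : p∣ sumFin n (λ j → + c j) - sumFin n (λ j → + (c j % p))
      p∣c-c%p = subst p∣_ (sum-- (sumFin-linear n) (λ j → + c j) (λ j → + (c j % p)))
        (p∣-sumFin n (λ j → + c j - + (c j % p)) (λ j → ≈⇒p∣- (c j) (c j % p) (sym (%-≈ (c j)))))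
      neg-minus : ∀ x y z → y ≡ z → - (x - y) ≡ z - x
      neg-minus x y z refl = flip x y
        where
        flip : ∀ x y → - (x - y) ≡ y - x
        flip = solve-∀

    coverClass : B n p → ℕ
    coverClass a = (expSum a - balancedSum q) %ℕ p

    coverClass<p : ∀ a → coverClass a ℕ.< p
    coverClass<p a = n%ℕd<d (expSum a - balancedSum q) p

    compatible⇒class : ∀ a b → Compatible a b → p∣ vecSum b + + coverClass a
    compatible⇒class a b compatible = subst p∣_ (regroup (balancedSum q) (expSum a) (vecSum b) (+ coverClass a))
      (∣m∣n⇒∣m+n (∣m⇒∣-m (subst (λ t → p∣ balancedSum q - t) (sumFin-residues a b) compatible)) (p∣x%ℕp-x (expSum a - balancedSum q)))
      where
      regroup : ∀ k s b u → - (k - (s + b)) + (u - (s - k)) ≡ b + u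
      regroup = solve-∀

    not-consecutive : ∀ X u → p∣ X + + u → ¬ (p∣ X + + suc u)
    not-consecutive X u p∣X+u p∣X+1+u = p∤1 (subst p∣_ (difference X u) (∣m∣n⇒∣m-n p∣X+1+u p∣X+u))
      where
      difference : ∀ X u → X + + suc u - (X + + u) ≡ + 1
      difference X u = trans (cong (λ t → X + t - (X + + u)) (pos-+ 1 u)) (cancel X (+ u))
        where
        cancel : ∀ X u → X + (+ 1 + u) - (X + u) ≡ + 1
        cancel = solve-∀

    pathValue-⊕ : ∀ L φ b τ → pathValue L φ (b ⊕ τ) ≈ pathValue L φ b ℕ.+ pathShift τ φ
    pathValue-⊕ [] [] b τ = refl
    pathValue-⊕ (a ∷ L) (j ∷ φ) b τ = trans
      (≈-+ {x = residues a (b ⊕ τ) j} (≈-+ {x = toℕ (a j)} refl (trans (cong (_% p) (lookup-⊕ b τ j)) (%-≈ _))) (pathValue-⊕ L φ b τ))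
      (cong (_% p) (regroup (toℕ (a j)) (lookup b j) (lookup τ j) (pathValue L φ b) (pathShift τ φ)))
      where
      regroup : ∀ a b t v s → a ℕ.+ (b ℕ.+ t) ℕ.+ (v ℕ.+ s) ≡ a ℕ.+ b ℕ.+ v ℕ.+ (t ℕ.+ s)
      regroup = ℕ-Solver.solve-∀

    δ-≈ : ∀ {x y} → x ≈ y → δ x ≡ δ y
    δ-≈ = cong (λ t → 𝟙 (t ℕ.≡ᵇ 0))

    coincidence-≈ : ∀ {x x′ y y′} → x ≈ x′ → y ≈ y′ → coincidence x y ≡ coincidence x′ y′
    coincidence-≈ x≈x′ y≈y′ = sum-cong (∑<-linear p) (λ r → cong₂ _*_ (δ-≈ (≈-+ x≈x′ refl)) (δ-≈ (≈-+ y≈y′ refl)))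

    coincidence-+ : ∀ x y d → coincidence (x ℕ.+ d) (y ℕ.+ d) ≡ coincidence x y
    coincidence-+ x y d = trans
      (sum-cong (∑<-linear p) (λ r → cong₂ (λ s t → δ s * δ t) (ℕ.+-assoc x d r) (ℕ.+-assoc y d r)))
      (periodSum-from (λ r → cong₂ _*_ (δ-shift-periodic x r) (δ-shift-periodic y r)) d)

    pairTerm-⊕ : ∀ L φ ψ b τ → pathShift τ φ ≈ pathShift τ ψ → pairTerm L φ ψ (b ⊕ τ) ≡ pairTerm L φ ψ b
    pairTerm-⊕ L φ ψ b τ same-shift = cong (λ t → + p * t - + 1) (trans
      (coincidence-≈ (pathValue-⊕ L φ b τ) (trans (pathValue-⊕ L ψ b τ) (≈-+ {x = pathValue L ψ b} refl (sym same-shift))))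
      (coincidence-+ (pathValue L φ b) (pathValue L ψ b) (pathShift τ φ)))

    vecSum-⊕ : ∀ (b τ : Vec ℕ n) → p∣ vecSum (b ⊕ τ) - (vecSum b + vecSum τ)
    vecSum-⊕ b τ = subst p∣_ sum-difference (p∣-sumFin n _ (λ j →
      subst (λ t → p∣ + lookup (b ⊕ τ) j - t) (pos-+ (lookup b j) (lookup τ j))
        (≈⇒p∣- (lookup (b ⊕ τ) j) (lookup b j ℕ.+ lookup τ j) (trans (cong (_% p) (lookup-⊕ b τ j)) (%-≈ _)))))
      where
      sum-difference : sumFin n (λ j → + lookup (b ⊕ τ) j - (+ lookup b j + + lookup τ j)) ≡ vecSum (b ⊕ τ) - (vecSum b + vecSum τ)
      sum-difference = trans (sum-- (sumFin-linear n) (λ j → + lookup (b ⊕ τ) j) (λ j → + lookup b j + + lookup τ j))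
                             (cong (λ t → vecSum (b ⊕ τ) - t) (sum-+ (sumFin-linear n) (λ j → + lookup b j) (λ j → + lookup τ j)))

    inClass : Vec ℕ n → ℕ → ℤ
    inClass b u = 𝟙 (does (+ p ∣? vecSum b + + u))

    inClass-yes : ∀ b u → p∣ vecSum b + + u → inClass b u ≡ + 1
    inClass-yes b u p∣b+u = cong 𝟙 (dec-true (+ p ∣? vecSum b + + u) p∣b+u)

    inClass-no : ∀ b u → ¬ (p∣ vecSum b + + u) → inClass b u ≡ + 0
    inClass-no b u p∤b+u = cong 𝟙 (dec-false (+ p ∣? vecSum b + + u) p∤b+u)

    inClass-⊕ : ∀ b τ u → p∣ vecSum τ - + 1 → inClass (b ⊕ τ) u ≡ inClass b (suc u)
    inClass-⊕ b τ u p∣τ-1 = cong 𝟙 (does-⇔ (p∣-⇔ (vecSum (b ⊕ τ) + + u) (vecSum b + + suc u) p∣diff) (+ p ∣? vecSum (b ⊕ τ) + + u) (+ p ∣? vecSum b + + suc u))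
      where
      p∣diff : p∣ (vecSum (b ⊕ τ) + + u) - (vecSum b + + suc u)
      p∣diff = subst p∣_ (trans (regroup (vecSum (b ⊕ τ)) (vecSum b) (vecSum τ) (+ u)) (cong (λ t → vecSum (b ⊕ τ) + + u - (vecSum b + t)) (sym (pos-+ 1 u))))
        (∣m∣n⇒∣m+n (vecSum-⊕ b τ) p∣τ-1)
        where
        regroup : ∀ A B T u → A - (B + T) + (T - + 1) ≡ A + u - (B + (+ 1 + u))
        regroup = solve-∀

    classEnergy : List (B n p) → ℕ → ℤ
    classEnergy L u = ∑Box n (λ b → inClass b u * energy L b)

    pairClassEnergy : (L : List (B n p)) → ℕ → (φ ψ : Vec (Fin n) (length L)) → ℤ
    pairClassEnergy L u φ ψ = ∑Box n (λ b → inClass b u * pairTerm L φ ψ b)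

    classEnergy≡ : ∀ L u → classEnergy L u ≡ ∑Path (length L) (λ φ → ∑Path (length L) (λ ψ → pairClassEnergy L u φ ψ))
    classEnergy≡ L u = begin
      ∑Box n (λ b → inClass b u * energy L b)
        ≡⟨ sum-cong (∑Box-linear n) (λ b → trans (sym (sum-*ˡ Path (inClass b u) _)) (sum-cong Path (λ φ → sym (sum-*ˡ Path (inClass b u) _)))) ⟩
      ∑Box n (λ b → ∑Path m (λ φ → ∑Path m (λ ψ → inClass b u * pairTerm L φ ψ b)))
        ≡⟨ ∑Box-fubini n Path (λ b φ → ∑Path m (λ ψ → inClass b u * pairTerm L φ ψ b)) ⟩
      ∑Path m (λ φ → ∑Box n (λ b → ∑Path m (λ ψ → inClass b u * pairTerm L φ ψ b)))
        ≡⟨ sum-cong Path (λ φ → ∑Box-fubini n Path (λ b ψ → inClass b u * pairTerm L φ ψ b)) ⟩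
      ∑Path m (λ φ → ∑Path m (λ ψ → pairClassEnergy L u φ ψ))
        ∎
      where
      open ≡-Reasoning
      m = length L
      Path = ∑Path-linear m

    -- The translation b ↦ b ⊕ τ moves class u + 1 onto class u and, shifting φ and ψ by the
    -- same amount mod p, leaves their pair term unchanged.
    classEnergy-suc : ∀ L u → Translatable n (length L) → classEnergy L u ≡ classEnergy L (suc u)
    classEnergy-suc L u translatable = begin
      classEnergy L u                                                  ≡⟨ classEnergy≡ L u ⟩
      ∑Path m (λ φ → ∑Path m (λ ψ → pairClassEnergy L u φ ψ))          ≡⟨ sum-cong Path (λ φ → sum-cong Path (λ ψ → pair-suc φ ψ)) ⟩
      ∑Path m (λ φ → ∑Path m (λ ψ → pairClassEnergy L (suc u) φ ψ))    ≡⟨ sym (classEnergy≡ L (suc u)) ⟩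
      classEnergy L (suc u)                                            ∎
      where
      open ≡-Reasoning
      m = length L
      Path = ∑Path-linear m
      pair-suc : ∀ φ ψ → pairClassEnergy L u φ ψ ≡ pairClassEnergy L (suc u) φ ψ
      pair-suc φ ψ with translatable φ ψ
      ... | τ , p∣τ-1 , same-shift = trans (sym (∑Box-translate n (λ b → inClass b u * pairTerm L φ ψ b) τ))
        (sum-cong (∑Box-linear n) (λ b → cong₂ _*_ (inClass-⊕ b τ u p∣τ-1) (pairTerm-⊕ L φ ψ b τ same-shift)))

  -- Translations

  basis : ∀ {n} → Fin n → Fin n → ℕ
  basis i j = if does (i Fin.≟ j) then 1 else 0

  sumFin-basisˡ : ∀ n (j₀ : Fin n) → sumFin n (λ j → + basis j j₀) ≡ + 1
  sumFin-basisˡ (suc n) fzero = cong (λ t → + 1 + t) (zeros n)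
    where
    zeros : ∀ n → sumFin n (λ j → + basis (fsuc j) (fzero {n})) ≡ + 0
    zeros zero = refl
    zeros (suc n) = trans (+-identityˡ _) (zeros n)
  sumFin-basisˡ (suc n) (fsuc j₀) = trans (+-identityˡ _) (sumFin-basisˡ n j₀)

  sumFin-basisʳ : ∀ n (j₀ : Fin n) → sumFin n (λ j → + basis j₀ j) ≡ + 1
  sumFin-basisʳ (suc n) fzero = cong (λ t → + 1 + t) (zeros n)
    where
    zeros : ∀ n → sumFin n (λ j → + basis (fzero {n}) (fsuc j)) ≡ + 0
    zeros zero = refl
    zeros (suc n) = trans (+-identityˡ _) (zeros n)
  sumFin-basisʳ (suc n) (fsuc j₀) = trans (+-identityˡ _) (sumFin-basisʳ n j₀)

  multiplicity : ∀ {n m} → Vec (Fin n) m → Fin n → ℕ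
  multiplicity [] j = 0
  multiplicity (i ∷ φ) j = basis i j ℕ.+ multiplicity φ j

  sumFin-multiplicity : ∀ {n m} (φ : Vec (Fin n) m) → sumFin n (λ j → + multiplicity φ j) ≡ + m
  sumFin-multiplicity {n} [] = trans (sumFin-const n (+ 0)) (*-zeroʳ (+ n))
  sumFin-multiplicity {n} {suc m} (i ∷ φ) = begin
    sumFin n (λ j → + (basis i j ℕ.+ multiplicity φ j))                   ≡⟨ sum-cong (sumFin-linear n) (λ j → pos-+ (basis i j) (multiplicity φ j)) ⟩
    sumFin n (λ j → + basis i j + + multiplicity φ j)                      ≡⟨ sum-+ (sumFin-linear n) _ _ ⟩
    sumFin n (λ j → + basis i j) + sumFin n (λ j → + multiplicity φ j)    ≡⟨ cong₂ _+_ (sumFin-basisʳ n i) (sumFin-multiplicity φ) ⟩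
    + 1 + + m                                                              ≡⟨ sym (pos-+ 1 m) ⟩
    + suc m                                                                ∎
    where open ≡-Reasoning

  twoPoint : ∀ {n} → ℕ → Fin n → ℕ → Fin n → Vec ℕ n
  twoPoint x j₀ y j₁ = tabulate (λ j → x ℕ.* basis j j₀ ℕ.+ y ℕ.* basis j j₁)

  pathShift-twoPoint : ∀ {n} x j₀ y j₁ {m} (φ : Vec (Fin n) m) →
    pathShift (twoPoint x j₀ y j₁) φ ≡ x ℕ.* multiplicity φ j₀ ℕ.+ y ℕ.* multiplicity φ j₁
  pathShift-twoPoint x j₀ y j₁ [] = zeros x y
    where
    zeros : ∀ x y → 0 ≡ x ℕ.* 0 ℕ.+ y ℕ.* 0
    zeros = ℕ-Solver.solve-∀
  pathShift-twoPoint x j₀ y j₁ (j ∷ φ) =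
    trans (cong₂ ℕ._+_ (Vec.lookup∘tabulate (λ j′ → x ℕ.* basis j′ j₀ ℕ.+ y ℕ.* basis j′ j₁) j) (pathShift-twoPoint x j₀ y j₁ φ))
          (distrib x y (basis j j₀) (basis j j₁) (multiplicity φ j₀) (multiplicity φ j₁))
    where
    distrib : ∀ x y a b c d → x ℕ.* a ℕ.+ y ℕ.* b ℕ.+ (x ℕ.* c ℕ.+ y ℕ.* d) ≡ x ℕ.* (a ℕ.+ c) ℕ.+ y ℕ.* (b ℕ.+ d)
    distrib = ℕ-Solver.solve-∀

  vecSum-twoPoint : ∀ {n} x (j₀ : Fin n) y j₁ → vecSum (twoPoint x j₀ y j₁) ≡ + x + + y
  vecSum-twoPoint {n} x j₀ y j₁ = begin
    sumFin n (λ j → + lookup (twoPoint x j₀ y j₁) j)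
      ≡⟨ sum-cong (sumFin-linear n) (λ j → trans (cong +_ (Vec.lookup∘tabulate (λ j′ → x ℕ.* basis j′ j₀ ℕ.+ y ℕ.* basis j′ j₁) j))
                                                   (trans (pos-+ (x ℕ.* basis j j₀) _) (cong₂ _+_ (pos-* x (basis j j₀)) (pos-* y (basis j j₁))))) ⟩
    sumFin n (λ j → + x * + basis j j₀ + + y * + basis j j₁)
      ≡⟨ sum-+ (sumFin-linear n) _ _ ⟩
    sumFin n (λ j → + x * + basis j j₀) + sumFin n (λ j → + y * + basis j j₁)
      ≡⟨ cong₂ _+_ (sum-*ˡ (sumFin-linear n) (+ x) _) (sum-*ˡ (sumFin-linear n) (+ y) _) ⟩
    + x * sumFin n (λ j → + basis j j₀) + + y * sumFin n (λ j → + basis j j₁)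
      ≡⟨ cong₂ (λ s t → + x * s + + y * t) (sumFin-basisˡ n j₀) (sumFin-basisˡ n j₁) ⟩
    + x * + 1 + + y * + 1
      ≡⟨ cong₂ _+_ (*-identityʳ (+ x)) (*-identityʳ (+ y)) ⟩
    + x + + y
      ∎
    where open ≡-Reasoning

  p-1≤s*[p-s] : ∀ {p} s → 1 ℕ.≤ s → s ℕ.< p → p ∸ 1 ℕ.≤ s ℕ.* (p ∸ s)
  p-1≤s*[p-s] {p} (suc s′) _ s<p = subst (λ t → t ∸ 1 ℕ.≤ suc s′ ℕ.* (p ∸ suc s′)) s+t≡p
      (ℕ.≤-trans (ℕ.≤-reflexive (ℕ.+-comm s′ t)) (ℕ.+-monoʳ-≤ t (ℕ.m≤m*n s′ t {{ℕ.>-nonZero 0<t}})))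
    where
    t = p ∸ suc s′
    s+t≡p : suc s′ ℕ.+ t ≡ p
    s+t≡p = ℕ.m+[n∸m]≡n (ℕ.<⇒≤ s<p)
    0<t : 0 ℕ.< t
    0<t = ℕ.m<n⇒0<n∸m s<p

  module Translations (p : ℕ) {{_ : NonZero p}} (p-prime : Prime p) (n′ : ℕ) where
    open PeriodicSequences p
    open Congruence p

    n : ℕ
    n = suc n′

    pos-∸ : ∀ {a b} → b ℕ.≤ a → + (a ∸ b) ≡ + a - + b
    pos-∸ {a} {b} b≤a = sym (trans (m-n≡m⊖n a b) (⊖-≥ b≤a))

    p∣-⇒≤ : ∀ x {s} → s ℕ.< p → p∣ + x - + s → s ℕ.≤ x
    p∣-⇒≤ x {s} s<p p∣x-s = subst (ℕ._≤ x) (trans (p∣-⇒≈ x s p∣x-s) (m<n⇒m%n≡m s<p)) (m%n≤m x p)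

    modular-inverse : ∀ D → ¬ (p∣ D) → Σ[ w ∈ ℤ ] p∣ w * D - + 1
    modular-inverse D p∤D with D %ℕ p ℕ.≟ 0 | a≡a%ℕn+[a/ℕn]*n D p
    ... | yes r≡0 | D≡ = ⊥-elim (p∤D (divides (D /ℕ p) (trans D≡ (trans (cong (λ t → + t + (D /ℕ p) * + p) r≡0) (+-identityˡ _)))))
    ... | no r≢0 | D≡ = from-Bézout (coprime-Bézout (prime⇒coprime p-prime {{ℕ.≢-nonZero r≢0}} (n%ℕd<d D p)))
      where
      r = D %ℕ p
      k = D /ℕ p
      from-Bézout : Bézout.Identity 1 p r → Σ[ w ∈ ℤ ] p∣ w * D - + 1
      from-Bézout (Bézout.Identity.+- x y 1+yr≡xp) =
        - + y , divides (- + x - + y * k) (trans (cong (λ t → - + y * t - + 1) D≡) (rearrange (+ y) (+ r) k (+ p) (+ x) 1+yr≡xp′))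
        where
        1+yr≡xp′ : + 1 + + y * + r ≡ + x * + p
        1+yr≡xp′ = trans (cong (λ t → + 1 + t) (sym (pos-* y r))) (trans (sym (pos-+ 1 (y ℕ.* r))) (trans (cong +_ 1+yr≡xp) (pos-* x p)))
        rearrange : ∀ y r k p x → + 1 + y * r ≡ x * p → - y * (r + k * p) - + 1 ≡ (- x - y * k) * p
        rearrange y r k p x e = trans (expand y r k p) (trans (cong (λ t → - t - y * k * p) e) (factor x y k p))
          where
          expand : ∀ y r k p → - y * (r + k * p) - + 1 ≡ - (+ 1 + y * r) - y * k * p
          expand = solve-∀
          factor : ∀ x y k p → - (x * p) - y * k * p ≡ (- x - y * k) * p
          factor = solve-∀
      from-Bézout (Bézout.Identity.-+ x y 1+xp≡yr) =
        + y , divides (+ x + + y * k) (trans (cong (λ t → + y * t - + 1) D≡) (rearrange (+ y) (+ r) k (+ p) (+ x) 1+xp≡yr′))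
        where
        1+xp≡yr′ : + 1 + + x * + p ≡ + y * + r
        1+xp≡yr′ = trans (cong (λ t → + 1 + t) (sym (pos-* x p))) (trans (sym (pos-+ 1 (x ℕ.* p))) (trans (cong +_ 1+xp≡yr) (pos-* y r)))
        rearrange : ∀ y r k p x → + 1 + x * p ≡ y * r → y * (r + k * p) - + 1 ≡ (x + y * k) * p
        rearrange y r k p x e = trans (expand y r k p) (trans (cong (λ t → t + y * k * p - + 1) (sym e)) (factor x y k p))
          where
          expand : ∀ y r k p → y * (r + k * p) - + 1 ≡ y * r + y * k * p - + 1
          expand = solve-∀
          factor : ∀ x y k p → + 1 + x * p + y * k * p - + 1 ≡ (x + y * k) * p
          factor = solve-∀

    -- Either a ∸ b ≥ s or b ∸ a ≥ p - s.
    difference-bound : ∀ a b {s} → 1 ℕ.≤ s → s ℕ.< p → p∣ (+ a - + b) - + s → s ℕ.* (p ∸ s) ℕ.≤ (p ∸ s) ℕ.* (a ∸ b) ℕ.+ s ℕ.* (b ∸ a)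
    difference-bound a b {s} 1≤s s<p p∣a-b-s with b ℕ.≤? a
    ... | yes b≤a = ℕ.≤-trans (ℕ.≤-trans (ℕ.≤-reflexive (ℕ.*-comm s (p ∸ s))) (ℕ.*-monoʳ-≤ (p ∸ s) s≤a-b)) (ℕ.m≤m+n _ _)
      where
      s≤a-b : s ℕ.≤ a ∸ b
      s≤a-b = p∣-⇒≤ (a ∸ b) s<p (subst (λ t → p∣ t - + s) (sym (pos-∸ b≤a)) p∣a-b-s)
    ... | no b≰a = ℕ.≤-trans (ℕ.*-monoʳ-≤ s p-s≤b-a) (ℕ.m≤n+m _ _)
      where
      a≤b : a ℕ.≤ b
      a≤b = ℕ.<⇒≤ (ℕ.≰⇒> b≰a)
      flip : ∀ a b s p → - ((a - b) - s) - p ≡ (b - a) - (p - s)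
      flip = solve-∀
      p∣b-a-[p-s] : p∣ + (b ∸ a) - + (p ∸ s)
      p∣b-a-[p-s] = subst p∣_ (trans (flip (+ a) (+ b) (+ s) (+ p)) (cong₂ _-_ (sym (pos-∸ a≤b)) (sym (pos-∸ (ℕ.<⇒≤ s<p)))))
        (∣m∣n⇒∣m-n (∣m⇒∣-m p∣a-b-s) ∣-refl)
      p-s≤b-a : p ∸ s ℕ.≤ b ∸ a
      p-s≤b-a = p∣-⇒≤ (b ∸ a) (ℕ.∸-monoʳ-< {o = 0} 1≤s (ℕ.<⇒≤ s<p)) p∣b-a-[p-s]

    module _ {m} (φ ψ : Vec (Fin n) m) where
      private
        α β : Fin n → ℕ
        α = multiplicity φ
        β = multiplicity ψ
        d : Fin n → ℤ
        d j = + α j - + β j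
        d-difference : ∀ j → + (α j ℕ.+ β fzero) - + (β j ℕ.+ α fzero) ≡ d j - d fzero
        d-difference j = trans (cong₂ _-_ (pos-+ (α j) (β fzero)) (pos-+ (β j) (α fzero))) (regroup (+ α j) (+ β fzero) (+ β j) (+ α fzero))
          where
          regroup : ∀ a b c e → a + b - (c + e) ≡ a - c - (e - b)
          regroup = solve-∀

      -- The witness is τ = (x mod p) e₀ + (y mod p) eⱼ.
      twoPoint-translation : ∀ j x y → p∣ x + y - + 1 → p∣ x * d fzero + y * d j → Translation φ ψ
      twoPoint-translation j x y p∣x+y-1 p∣xd₀+ydⱼ = τ , p∣τ-1 , same-shift
        where
        X Y : ℕ
        X = x %ℕ p
        Y = y %ℕ p
        τ = twoPoint X fzero Y j
        p∣τ-1 : p∣ vecSum τ - + 1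
        p∣τ-1 = subst p∣_ (trans (regroup (+ X) (+ Y) x y) (cong (_- + 1) (sym (vecSum-twoPoint X fzero Y j))))
          (∣m∣n⇒∣m+n (∣m∣n⇒∣m+n (p∣x%ℕp-x x) (p∣x%ℕp-x y)) p∣x+y-1)
          where
          regroup : ∀ X Y x y → X - x + (Y - y) + (x + y - + 1) ≡ X + Y - + 1
          regroup = solve-∀
        pathShift-τ : ∀ (χ : Vec (Fin n) m) → + pathShift τ χ ≡ + X * + multiplicity χ fzero + + Y * + multiplicity χ j
        pathShift-τ χ = trans (cong +_ (pathShift-twoPoint X fzero Y j χ))
          (trans (pos-+ (X ℕ.* multiplicity χ fzero) (Y ℕ.* multiplicity χ j)) (cong₂ _+_ (pos-* X _) (pos-* Y _)))
        same-shift : pathShift τ φ ≈ pathShift τ ψ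
        same-shift = p∣-⇒≈ _ _ (subst p∣_ (trans (regroup (+ X) (+ Y) x y (+ α fzero) (+ β fzero) (+ α j) (+ β j))
                                                (sym (cong₂ _-_ (pathShift-τ φ) (pathShift-τ ψ))))
          (∣m∣n⇒∣m+n (∣m∣n⇒∣m+n (∣n⇒∣m*n (d fzero) (p∣x%ℕp-x x)) (∣n⇒∣m*n (d j) (p∣x%ℕp-x y))) p∣xd₀+ydⱼ))
          where
          regroup : ∀ X Y x y a₀ b₀ aⱼ bⱼ →
            (a₀ - b₀) * (X - x) + (aⱼ - bⱼ) * (Y - y) + (x * (a₀ - b₀) + y * (aⱼ - bⱼ)) ≡ X * a₀ + Y * aⱼ - (X * b₀ + Y * bⱼ)
          regroup = solve-∀

      equal-multiplicity⇒translation : ∀ j → α j ≈ β j → Translation φ ψ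
      equal-multiplicity⇒translation j αj≈βj = twoPoint-translation j (+ 0) (+ 1) (divides (+ 0) refl)
        (subst p∣_ (sym (trans (cong₂ _+_ (*-zeroˡ (d fzero)) (*-identityˡ (d j))) (+-identityˡ (d j)))) (≈⇒p∣- (α j) (β j) αj≈βj))

      -- With w the inverse of d₀ - dⱼ mod p, take x = -dⱼ w and y = d₀ w.
      distinct-differences⇒translation : ∀ j → ¬ (α j ℕ.+ β fzero ≈ β j ℕ.+ α fzero) → Translation φ ψ
      distinct-differences⇒translation j d₀≉dⱼ =
        let w , p∣wD-1 = modular-inverse (d fzero - d j) p∤D
        in twoPoint-translation j (- d j * w) (d fzero * w)
             (subst p∣_ (sum≡ w (d fzero) (d j)) p∣wD-1) (subst p∣_ (sym (cancel w (d fzero) (d j))) (divides (+ 0) refl))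
        where
        sum≡ : ∀ w a b → w * (a - b) - + 1 ≡ - b * w + a * w - + 1
        sum≡ = solve-∀
        cancel : ∀ w a b → - b * w * a + a * w * b ≡ + 0
        cancel = solve-∀
        neg-minus : ∀ a b → - (a - b) ≡ b - a
        neg-minus = solve-∀
        p∤D : ¬ (p∣ d fzero - d j)
        p∤D p∣D = d₀≉dⱼ (p∣-⇒≈ _ _ (subst p∣_ (trans (neg-minus (d fzero) (d j)) (sym (d-difference j))) (∣m⇒∣-m p∣D)))

      weighted-excess≤ : ∀ t s → sumFin n (λ j → + (t ℕ.* (α j ∸ β j) ℕ.+ s ℕ.* (β j ∸ α j))) ≤ + ((t ℕ.+ s) ℕ.* m)
      weighted-excess≤ t s = begin
        sumFin n (λ j → + (t ℕ.* (α j ∸ β j) ℕ.+ s ℕ.* (β j ∸ α j)))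
          ≡⟨ sum-cong (sumFin-linear n) (λ j → trans (pos-+ (t ℕ.* (α j ∸ β j)) (s ℕ.* (β j ∸ α j))) (cong₂ _+_ (pos-* t _) (pos-* s _))) ⟩
        sumFin n (λ j → + t * + (α j ∸ β j) + + s * + (β j ∸ α j))
          ≡⟨ trans (sum-+ (sumFin-linear n) (λ j → + t * + (α j ∸ β j)) (λ j → + s * + (β j ∸ α j)))
                   (cong₂ _+_ (sum-*ˡ (sumFin-linear n) (+ t) (λ j → + (α j ∸ β j))) (sum-*ˡ (sumFin-linear n) (+ s) (λ j → + (β j ∸ α j)))) ⟩
        + t * sumFin n (λ j → + (α j ∸ β j)) + + s * sumFin n (λ j → + (β j ∸ α j))
          ≤⟨ +-mono-≤ (*-monoˡ-≤-nonNeg (+ t) (sumFin-∸≤ α β (sumFin-multiplicity φ))) (*-monoˡ-≤-nonNeg (+ s) (sumFin-∸≤ β α (sumFin-multiplicity ψ))) ⟩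
        + t * + m + + s * + m
          ≡⟨ sym (*-distribʳ-+ (+ m) (+ t) (+ s)) ⟩
        (+ t + + s) * + m
          ≡⟨ trans (cong (_* + m) (sym (pos-+ t s))) (sym (pos-* (t ℕ.+ s) m)) ⟩
        + ((t ℕ.+ s) ℕ.* m)
          ∎
        where
        open ≤-Reasoning
        sumFin-∸≤ : ∀ {m′} (γ δ : Fin n → ℕ) → sumFin n (λ j → + γ j) ≡ + m′ → sumFin n (λ j → + (γ j ∸ δ j)) ≤ + m′
        sumFin-∸≤ γ δ Σγ≡m′ = ≤-trans (sum-mono (sumFin-linear n) _ _ (λ j → +≤+ (ℕ.m∸n≤m (γ j) (δ j)))) (≤-reflexive Σγ≡m′)

      -- If all dⱼ are ≡ s ≢ 0 (mod p), each j contributes at least s (p - s) ≥ p - 1 to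
      -- (p - s) Σⱼ (αⱼ ∸ βⱼ) + s Σⱼ (βⱼ ∸ αⱼ) ≤ (p - s) m + s m = p m.
      constant-difference⇒bound : (∀ j → α j ℕ.+ β fzero ≈ β j ℕ.+ α fzero) → ¬ (α fzero ≈ β fzero) → n ℕ.* (p ∸ 1) ℕ.≤ p ℕ.* m
      constant-difference⇒bound same-difference α₀≉β₀ = begin
        n ℕ.* (p ∸ 1)                                       ≤⟨ ℕ.*-monoʳ-≤ n (p-1≤s*[p-s] s 1≤s s<p) ⟩
        n ℕ.* (s ℕ.* (p ∸ s))                               ≤⟨ drop‿+≤+ (≤-trans (≤-reflexive (trans (pos-* n _) (sym (sumFin-const n _))))
                                                                (≤-trans (sum-mono (sumFin-linear n) _ _ excess≥) (weighted-excess≤ (p ∸ s) s))) ⟩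
        (p ∸ s ℕ.+ s) ℕ.* m                                 ≡⟨ cong (ℕ._* m) (ℕ.m∸n+n≡m (ℕ.<⇒≤ s<p)) ⟩
        p ℕ.* m                                             ∎
        where
        open ℕ.≤-Reasoning
        s = d fzero %ℕ p
        s<p : s ℕ.< p
        s<p = n%ℕd<d (d fzero) p
        flip : ∀ a → - (+ 0 - a) ≡ a
        flip = solve-∀
        1≤s : 1 ℕ.≤ s
        1≤s = ℕ.n≢0⇒n>0 λ s≡0 → α₀≉β₀ (p∣-⇒≈ (α fzero) (β fzero)
          (subst p∣_ (flip (d fzero)) (∣m⇒∣-m (subst (λ t → p∣ + t - d fzero) s≡0 (p∣x%ℕp-x (d fzero))))))
        telescope : ∀ a b c → a - b + - (c - b) ≡ a - c
        telescope = solve-∀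
        p∣dⱼ-s : ∀ j → p∣ d j - + s
        p∣dⱼ-s j = subst p∣_ (telescope (d j) (d fzero) (+ s))
          (∣m∣n⇒∣m+n (subst p∣_ (d-difference j) (≈⇒p∣- _ _ (same-difference j))) (∣m⇒∣-m (p∣x%ℕp-x (d fzero))))
        excess≥ : ∀ j → + (s ℕ.* (p ∸ s)) ≤ + ((p ∸ s) ℕ.* (α j ∸ β j) ℕ.+ s ℕ.* (β j ∸ α j))
        excess≥ j = +≤+ (difference-bound (α j) (β j) 1≤s s<p (p∣dⱼ-s j))

    private
      same-difference? : ∀ {m} (φ ψ : Vec (Fin n) m) j →
        Dec (multiplicity φ j ℕ.+ multiplicity ψ fzero ≈ multiplicity ψ j ℕ.+ multiplicity φ fzero)
      same-difference? φ ψ j = _ ℕ.≟ _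

    translatable : ∀ {m} → p ℕ.* m ℕ.< n ℕ.* (p ∸ 1) → Translatable n m
    translatable few φ ψ with Fin.any? (λ j → multiplicity φ j % p ℕ.≟ multiplicity ψ j % p)
    ... | yes (j , αj≈βj) = equal-multiplicity⇒translation φ ψ j αj≈βj
    ... | no none-equal with Fin.any? (λ j → ¬? (same-difference? φ ψ j))
    ...   | yes (j , d₀≢dⱼ) = distinct-differences⇒translation φ ψ j d₀≢dⱼ
    ...   | no none-distinct = ⊥-elim (ℕ.<⇒≱ few (constant-difference⇒bound φ ψ
            (λ j → decidable-stable (same-difference? φ ψ j) (λ d₀≢dⱼ → none-distinct (j , d₀≢dⱼ)))
            (λ α₀≈β₀ → none-equal (fzero , α₀≈β₀))))

  -- Counting the covering vectors

  any-filter : ∀ {A : Set} {P Q : A → Set} (Q? : Decidable Q) {xs} → Any (λ a → P a × Q a) xs → Any P (filter Q? xs)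
  any-filter Q? {x ∷ xs} (here (px , qx)) rewrite filter-accept Q? {x} {xs} qx = here px
  any-filter Q? {x ∷ xs} (there any) with does (Q? x)
  ... | true = there (any-filter Q? any)
  ... | false = any-filter Q? any

  ∑<-length-filter : ∀ {A : Set} p (c : A → ℕ) → (∀ a → c a ℕ.< p) → ∀ xs →
    ∑< p (λ u → + length (filter (λ a → c a ℕ.≟ u) xs)) ≡ + length xs
  ∑<-length-filter p c c<p [] = trans (∑<-const p (+ 0)) (*-zeroʳ (+ p))
  ∑<-length-filter p c c<p (x ∷ xs) = begin
    ∑< p (λ u → + length (filter (λ a → c a ℕ.≟ u) (x ∷ xs)))                          ≡⟨ sum-cong (∑<-linear p) length-∷ ⟩
    ∑< p (λ u → 𝟙 (c x ≡ᵇ u) * + 1 + + length (filter (λ a → c a ℕ.≟ u) xs))          ≡⟨ sum-+ (∑<-linear p) _ _ ⟩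
    ∑< p (λ u → 𝟙 (c x ≡ᵇ u) * + 1) + ∑< p (λ u → + length (filter (λ a → c a ℕ.≟ u) xs))
                                                                                       ≡⟨ cong₂ _+_ (∑<-select p (c x) (λ _ → + 1) (c<p x)) (∑<-length-filter p c c<p xs) ⟩
    + 1 + + length xs                                                                  ≡⟨ sym (pos-+ 1 (length xs)) ⟩
    + length (x ∷ xs)                                                                  ∎
    where
    open ≡-Reasoning
    length-∷ : ∀ u → + length (filter (λ a → c a ℕ.≟ u) (x ∷ xs)) ≡ 𝟙 (c x ≡ᵇ u) * + 1 + + length (filter (λ a → c a ℕ.≟ u) xs)
    length-∷ u with c x ≡ᵇ u
    ... | true = pos-+ 1 _
    ... | false = sym (+-identityˡ _)

  module Counting (p : ℕ) {{_ : NonZero p}} (p-prime : Prime p) (n′ q : ℕ) (n≡qp : suc n′ ≡ q ℕ.* p) where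
    open PeriodicSequences p
    open Convolution p p-prime
    open Residues p
    open Boxes p
    open Congruence p
    open Paths p p-prime {q = q} n≡qp
    open Energy p p-prime {q = q} n≡qp
    open Classes p p-prime {q = q} n≡qp
    open Translations p p-prime n′

    inClass-energy-nonneg : ∀ L b u → + 0 ≤ inClass b u * energy L b
    inClass-energy-nonneg L b u = 𝟙-*-nonneg (does (+ p ∣? vecSum b + + u)) (energy-nonneg L b)
      where
      𝟙-*-nonneg : ∀ x {e} → + 0 ≤ e → + 0 ≤ 𝟙 x * e
      𝟙-*-nonneg true {e} e≥0 = ≤-trans e≥0 (≤-reflexive (sym (*-identityˡ e)))
      𝟙-*-nonneg false {e} e≥0 = ≤-reflexive (sym (*-zeroˡ e))

    classEnergy-zero : ∀ L u → (∀ b → p∣ vecSum b + + u → Any (λ a → Covers a b) L) → classEnergy L u ≡ + 0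
    classEnergy-zero L u covered = trans (sum-cong (∑Box-linear n) (λ b → term≡0 b (+ p ∣? vecSum b + + u))) (sum-zero (∑Box-linear n))
      where
      term≡0 : ∀ b → Dec (p∣ vecSum b + + u) → inClass b u * energy L b ≡ + 0
      term≡0 b (yes p∣b+u) = trans (cong (_* energy L b) (inClass-yes b u p∣b+u))
        (trans (*-identityˡ (energy L b)) (constant⇒energy-zero L b (covered⇒pathCount-constant (covered b p∣b+u))))
      term≡0 b (no p∤b+u) = trans (cong (_* energy L b) (inClass-no b u p∤b+u)) (*-zeroˡ (energy L b))

    class-representative : ∀ u → u ℕ.< p → Σ[ b ∈ Vec ℕ n ] AllVec (ℕ._< p) b × p∣ vecSum b + + suc u
    class-representative u u<p = (p ∸ suc u) ∷ replicate n′ 0 , (ℕ.∸-monoʳ-< {o = 0} (ℕ.s≤s ℕ.z≤n) u<p ∷ zeros<p n′) ,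
      subst p∣_ (sym sum≡p) ∣-refl
      where
      zeros<p : ∀ m → AllVec (ℕ._< p) (replicate m 0)
      zeros<p zero = []
      zeros<p (suc m) = ℕ.>-nonZero⁻¹ p ∷ zeros<p m
      vecSum-zeros : ∀ m → vecSum (replicate m 0) ≡ + 0
      vecSum-zeros zero = refl
      vecSum-zeros (suc m) = trans (+-identityˡ _) (vecSum-zeros m)
      sum≡p : vecSum ((p ∸ suc u) ∷ replicate n′ 0) + + suc u ≡ + p
      sum≡p = trans (cong (λ t → + (p ∸ suc u) + t + + suc u) (vecSum-zeros n′))
        (trans (cong (_+ + suc u) (+-identityʳ (+ (p ∸ suc u)))) (trans (sym (pos-+ (p ∸ suc u) (suc u))) (cong +_ (ℕ.m∸n+n≡m u<p))))

    -- Every b of class u + 1 is incompatible with all of L, so its pathCount is not constant.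
    classEnergy-pos : ∀ L u → u ℕ.< p → All (λ a → coverClass a ≡ u) L → + 0 < classEnergy L (suc u)
    classEnergy-pos L u u<p L-in-class =
      let b , b<p , p∣b+1+u = class-representative u u<p
          incompatible : All (λ a → ¬ Compatible a b) L
          incompatible = All.map (λ {a} class≡u compatible → not-consecutive (vecSum b) u
            (subst (λ t → p∣ vecSum b + + t) class≡u (compatible⇒class a b compatible)) p∣b+1+u) L-in-class
          r , r<p , Fr≢F0 = nonconstant⇒witness (pathCount-periodic L b)
            (DiffForm⇒nonconstant (length L) (pathCount L b) (DiffForm-pathCount L b incompatible))
      in begin-strict
        + 0                                     <⟨ nonconstant⇒energy-pos L b r r<p Fr≢F0 ⟩
        energy L b                              ≡⟨ sym (trans (cong (_* energy L b) (inClass-yes b (suc u) p∣b+1+u)) (*-identityˡ (energy L b))) ⟩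
        inClass b (suc u) * energy L b          ≤⟨ ∑Box-term≤ n (λ b → inClass b (suc u) * energy L b) (λ b → inClass-energy-nonneg L b (suc u)) b<p ⟩
        classEnergy L (suc u)                   ∎
      where open ≤-Reasoning

    class-size-bound : ∀ L u → u ℕ.< p → All (λ a → coverClass a ≡ u) L →
      (∀ b → p∣ vecSum b + + u → Any (λ a → Covers a b) L) → n ℕ.* (p ∸ 1) ℕ.≤ p ℕ.* length L
    class-size-bound L u u<p L-in-class covered = ℕ.≮⇒≥ λ L-small →
      <-irrefl (sym (classEnergy-zero L u covered))
        (<-≤-trans (classEnergy-pos L u u<p L-in-class) (≤-reflexive (sym (classEnergy-suc L u (translatable L-small)))))

    module _ (k : ℕ) (v : Fin k → B n p) (covering : (w : B n p) → ∃ λ i → IsZero p (dot n p (v i) w)) where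

      classList : ℕ → List (B n p)
      classList u = filter (λ a → coverClass a ℕ.≟ u) (List.tabulate v)

      classList-covers : ∀ u → u ℕ.< p → ∀ b → p∣ vecSum b + + u → Any (λ a → Covers a b) (classList u)
      classList-covers u u<p b p∣b+u =
        let i , vi-covers = covering (toB b)
            class≡u : coverClass (v i) ≡ u
            class≡u = residue-unique (vecSum b) (coverClass<p (v i)) u<p
              (compatible⇒class (v i) b (covers⇒compatible (v i) b vi-covers)) p∣b+u
        in any-filter (λ a → coverClass a ℕ.≟ u) (any-tabulate⁺ i (vi-covers , class≡u))

      ∑<-classList : ∑< p (λ u → + length (classList u)) ≡ + k
      ∑<-classList = trans (∑<-length-filter p coverClass coverClass<p (List.tabulate v)) (cong +_ (length-tabulate v))

      covering-size : n ℕ.* (p ∸ 1) ℕ.≤ k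
      covering-size = ℕ.*-cancelˡ-≤ p (drop‿+≤+ (begin
        + (p ℕ.* (n ℕ.* (p ∸ 1)))                  ≡⟨ pos-* p _ ⟩
        + p * + (n ℕ.* (p ∸ 1))                    ≡⟨ sym (∑<-const p _) ⟩
        ∑< p (λ _ → + (n ℕ.* (p ∸ 1)))             ≤⟨ ∑<-mono-< p _ _ (λ u u<p → +≤+ (class-size-bound (classList u) u u<p
                                                        (all-filter (λ a → coverClass a ℕ.≟ u) (List.tabulate v)) (classList-covers u u<p))) ⟩
        ∑< p (λ u → + (p ℕ.* length (classList u))) ≡⟨ sum-cong (∑<-linear p) (λ u → pos-* p (length (classList u))) ⟩
        ∑< p (λ u → + p * + length (classList u))   ≡⟨ sum-*ˡ (∑<-linear p) (+ p) _ ⟩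
        + p * ∑< p (λ u → + length (classList u))   ≡⟨ cong (+ p *_) ∑<-classList ⟩
        + p * + k                                   ≡⟨ sym (pos-* p k) ⟩
        + (p ℕ.* k)                                 ∎))
        where open ≤-Reasoning

open Covering using (module Counting)
open import Data.Nat using (ℕ; zero; suc; _*_; _∸_; _≤_; NonZero)
open import Data.Nat.Divisibility using (_∣_; divides)
open import Data.Nat.Primality using (Prime; prime⇒nonZero)
open import Data.Fin using (Fin)
open import Data.Product using (∃)

theorem1p1 : (n p : ℕ) → .{{_ : NonZero n}} → .{{_ : NonZero p}} →
    Prime p → p ∣ n →
    (k : ℕ) → (v : Fin k → B n p) →
    ((w : B n p) → ∃ λ (i : Fin k) → IsZero p (dot n p (v i) w)) →
    n * (p ∸ 1) ≤ k
theorem1p1 zero p {{()}}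
theorem1p1 (suc n′) p p-prime (divides q n≡qp) k v covering =
  Counting.covering-size p {{prime⇒nonZero p-prime}} p-prime n′ q n≡qp k v covering
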